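{- Soundness of $\vdash_1$ and $\vdash_2$. Let $i\in\{1,2\}$, let $\mathcal I$ be an interpretation, suppose $M:\langle(x_j^{n_j}:U_j)_{1\le j\le n}\vdash_i U\rangle$, and for every $1\le j\le n$ let $N_j\in\mathcal I(U_j)$. If $M[(x_j^{n_j}:=N_j)_{1\le j\le n}]\in\mathcal M$ (i.e. the substitution is defined), then $M[(x_j^{n_j}:=N_j)_{1\le j\le n}]\in\mathcal I(U)$. In particular, if $M:\langle()\vdash_i U\rangle$ then $M\in[U]$.
   Context: Terms ($\lambda I^{\mathbb N}$-calculus). Fix a denumerably infinite set $\mathcal V$ of variable names, partitioned as $\mathcal V=\mathcal V_1\cup\mathcal V_2$ with $\mathcal V_1,\mathcal V_2$ disjoint and denumerably infinite. Indexed variables are $x^n$ with $x\in\mathcal V$, $n\in\mathbb N$. The set $\mathcal M$ of terms, the set $\mathbb M\subseteq\mathcal M$ of good terms, free variables $FV$ and degree $d$ are defined simultaneously: $x^n\in\mathcal M\cap\mathbb M$, $FV(x^n)=\{x^n\}$, $d(x^n)=n$; if $M,N\in\mathcal M$ are joinable ($M\diamond N$: for all $x$, $x^m\in FV(M)$ and $x^n\in FV(N)$ imply $m=n$) then $MN\in\mathcal M$, $FV(MN)=FV(M)\cup FV(N)$, $d(MN)=\min(d(M),d(N))$, and $MN\in\mathbb M$ if moreover $M,N\in\mathbb M$ and $d(M)\le d(N)$; if $M\in\mathcal M$ and $x^n\in FV(M)$ then $\lambda x^n.M\in\mathcal M$, $FV(\lambda x^n.M)=FV(M)\setminus\{x^n\}$,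 $d(\lambda x^n.M)=d(M)$, and $\lambda x^n.M\in\mathbb M$ if $M\in\mathbb M$. $\mathcal M^n$ ($\mathbb M^n$) is the set of terms (good terms) of degree $n$. Terms are taken modulo $\alpha$-conversion; a simultaneous substitution $M[(x_i^{n_i}:=N_i)_i]$ is defined only when $M$ and all $N_i$ are pairwise joinable. $\rhd_\beta$ is the least compatible relation (closed under $\lambda x^n.\cdot$ when $x^n$ is free on both sides, and under application to/by a term joinable with both sides) containing $(\lambda x^n.M)N\rhd_\beta M[x^n:=N]$ when $d(N)=n$; $\rhd_\beta^*$ is its reflexive-transitive closure. $M^+$ replaces every variable index $n$ in $M$ by $n+1$; for $\mathcal X\subseteq\mathcal M$, $\mathcal X^+=\{M^+\mid M\in\mathcal X\}$. Types. Fix denumerably infinite sets $\mathcal A$ (atomic types) and $\mathcal E$ (expansion variables). $\mathcal T::=a\mid\mathcal T\to\mathcal T\mid\mathcal T\sqcap\mathcal T\mid e\,\mathcal T$ ($a\in\mathcal A$, $e\in\mathcal E$); $\mathbb U::=\mathbb U\sqcap\mathbb U\mid e\,\mathbb U\mid\mathbb T$ and $\mathbb T::=a\mid\mathbb U\to\mathbb T$, so $\mathbb T\subseteq\mathbb U\subseteq\mathcal T$. Types are quotiented by commutativity, associativity, idempotence of $\sqcap$ and $e(U_1\sqcap U_2)=eU_1\sqcap eU_2$. Degree: $d(a)=0$, $d(U\to T)=\min(d(U),d(T))$, $d(eU)=d(U)+1$, $d(U\sqcap V)=\min(d(U),d(V))$. Good types: atoms; $eU$ if $U$ good; $U\to T$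 if $U,T$ good and $d(U)\ge d(T)$; $U\sqcap V$ if $U,V$ good and $d(U)=d(V)$. Environments: finite sets $(x_i^{n_i}:U_i)_i$ with distinct $x_i^{n_i}$; $()$ is the empty one; $\Gamma,x^m:U$ adds a declaration for $x^m\notin dom(\Gamma)$; $\Gamma_1\sqcap\Gamma_2$ intersects the types of common variables and keeps the other declarations; $e\Gamma=(x_i^{n_i+1}:eU_i)_i$; $\Gamma_1\diamond\Gamma_2$ iff any $x^m\in dom(\Gamma_1)$, $x^n\in dom(\Gamma_2)$ have $m=n$. Typing rules of $\vdash_1$ (over $\mathcal T$): (ax) $x^n:\langle(x^n:T)\vdash_1 T\rangle$ if $T$ good and $d(T)=n$; ($\to_I$) from $M:\langle\Gamma,x^n:U\vdash_1 T\rangle$ infer $\lambda x^n.M:\langle\Gamma\vdash_1 U\to T\rangle$; ($\to_E$) from $M_1:\langle\Gamma_1\vdash_1 U\to T\rangle$, $M_2:\langle\Gamma_2\vdash_1 U\rangle$, $\Gamma_1\diamond\Gamma_2$ infer $M_1M_2:\langle\Gamma_1\sqcap\Gamma_2\vdash_1T\rangle$; ($\sqcap$) from $M:\langle\Gamma_1\vdash_1U_1\rangle$, $M:\langle\Gamma_2\vdash_1U_2\rangle$ infer $M:\langle\Gamma_1\sqcap\Gamma_2\vdash_1U_1\sqcap U_2\rangle$; (exp) from $M:\langle\Gamma\vdash_1U\rangle$ infer $M^+:\langle e\Gamma\vdash_1 eU\rangle$. Typing rules of $\vdash_2$ ($U$ over $\mathbb U$, $T$ over $\mathbb T$): the same ($\to_I$),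 ($\to_E$), ($\sqcap$), (exp) with $\vdash_2$; axiom $x^0:\langle(x^0:T)\vdash_2T\rangle$ if $T$ good; and ($\sqsubseteq$): from $M:\langle\Gamma\vdash_2U\rangle$ and $\langle\Gamma\vdash_2U\rangle\sqsubseteq\langle\Gamma'\vdash_2U'\rangle$ infer $M:\langle\Gamma'\vdash_2U'\rangle$, where $\sqsubseteq$ is the least relation (on $\mathbb U$, environments, typings) closed under reflexivity, transitivity, $U_1\sqcap U_2\sqsubseteq U_1$ (if $U_2$ good and $d(U_1)=d(U_2)$), $U_1\sqcap U_2\sqsubseteq V_1\sqcap V_2$ (if $U_i\sqsubseteq V_i$), $U_1\to T_1\sqsubseteq U_2\to T_2$ (if $U_2\sqsubseteq U_1$, $T_1\sqsubseteq T_2$), $eU_1\sqsubseteq eU_2$ (if $U_1\sqsubseteq U_2$), $\Gamma,(y^n:U_1)\sqsubseteq\Gamma,(y^n:U_2)$ (if $U_1\sqsubseteq U_2$), $\langle\Gamma_1\vdash_2U_1\rangle\sqsubseteq\langle\Gamma_2\vdash_2U_2\rangle$ (if $U_1\sqsubseteq U_2$, $\Gamma_2\sqsubseteq\Gamma_1$). Semantics. $\mathcal X\subseteq\mathcal M$ is saturated iff $M\rhd_\beta^*N$ and $N\in\mathcal X$ imply $M\in\mathcal X$. $\mathcal X\leadsto\mathcal Y=\{M\in\mathcal M\mid\forall N\in\mathcal X,\ M\diamond N\Rightarrow MN\in\mathcal Y\}$. For $x\in\mathcal V_1$, $\mathcal N_x^n=\{x^nN_1\dots N_k\in\mathbb M\mid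 k\ge0\}$. An interpretation is a function $\mathcal I:\mathcal A\to\mathcal P(\mathcal M^0)$ such that each $\mathcal I(a)$ is saturated and $\mathcal N_x^0\subseteq\mathcal I(a)\subseteq\mathbb M^0$ for all $x\in\mathcal V_1$; it is extended to $\mathcal T$ by $\mathcal I(eU)=\mathcal I(U)^+$, $\mathcal I(U\sqcap V)=\mathcal I(U)\cap\mathcal I(V)$, $\mathcal I(U\to T)=\mathcal I(U)\leadsto\mathcal I(T)$. The meaning of $U\in\mathcal T$ is $[U]=\{M\in\mathcal M\mid M\text{ closed and }M\in\mathcal I(U)\text{ for every interpretation }\mathcal I\}$. -}

module Defs where

open import Data.Nat using (ℕ; zero; suc; _≤_; _⊓_; _≡ᵇ_; _*_)
open import Data.Bool using (Bool; true; false; if_then_else_; _∧_)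
open import Data.Maybe using (Maybe; just; nothing)
open import Data.Maybe.Relation.Binary.Pointwise using (Pointwise)
open import Data.Product using (Σ; _×_; _,_; ∃)
open import Relation.Binary.PropositionalEquality using (_≡_)
open import Relation.Binary.Construct.Closure.ReflexiveTransitive using (Star)
open import Relation.Nullary using (¬_)

-- Variable names.  𝒱 = ℕ ;  𝒱₁ = even names, 𝒱₂ = odd names
-- (any partition into two infinite sets would do).

V₁ : ℕ → Set
V₁ x = Σ ℕ λ k → x ≡ 2 * k

-- Terms modulo α-conversion, in locally nameless representation.
-- fv x n   : the free indexed variable x^n
-- bv i n   : bound variable (de Bruijn index i), carrying its degree n
-- lam n B  : abstraction over a variable of degree n
-- The paper's  λx^n.M  is  lam n (close x n M)  (so α-equivalent terms
-- are syntactically equal).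

data Tm : Set where
  fv  : ℕ → ℕ → Tm
  bv  : ℕ → ℕ → Tm
  app : Tm → Tm → Tm
  lam : ℕ → Tm → Tm

closeAt : ℕ → ℕ → ℕ → Tm → Tm
closeAt k x n (fv y m)  = if (y ≡ᵇ x) ∧ (m ≡ᵇ n) then bv k n else fv y m
closeAt k x n (bv i m)  = bv i m
closeAt k x n (app M N) = app (closeAt k x n M) (closeAt k x n N)
closeAt k x n (lam m B) = lam m (closeAt (suc k) x n B)

close : ℕ → ℕ → Tm → Tm
close = closeAt 0

ƛ : ℕ → ℕ → Tm → Tm
ƛ x n M = lam n (close x n M)

data FV (x n : ℕ) : Tm → Set where
  fv-var : FV x n (fv x n)
  fv-appˡ : ∀ {M N} → FV x n M → FV x n (app M N)
  fv-appʳ : ∀ {M N} → FV x n N → FV x n (app M N)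
  fv-lam  : ∀ {m B} → FV x n B → FV x n (lam m B)

Closed : Tm → Set
Closed M = ∀ x n → ¬ FV x n M

Joinable : Tm → Tm → Set
Joinable M N = ∀ x m n → FV x m M → FV x n N → m ≡ n

deg : Tm → ℕ
deg (fv x n)  = n
deg (bv i n)  = n
deg (app M N) = deg M ⊓ deg N
deg (lam n B) = deg B

data IsTerm : Tm → Set where
  t-var : ∀ x n → IsTerm (fv x n)
  t-app : ∀ {M N} → IsTerm M → IsTerm N → Joinable M N → IsTerm (app M N)
  t-lam : ∀ {x n M} → IsTerm M → FV x n M → IsTerm (ƛ x n M)

data Good : Tm → Set where
  g-var : ∀ x n → Good (fv x n)
  g-app : ∀ {M N} → Good M → Good N → Joinable M N → deg M ≤ deg N → Good (app M N)
  g-lam : ∀ {x n M} → Good M → FV x n M → Good (ƛ x n M)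

plus : Tm → Tm
plus (fv x n)  = fv x (suc n)
plus (bv i n)  = bv i (suc n)
plus (app M N) = app (plus M) (plus N)
plus (lam n B) = lam (suc n) (plus B)

-- single substitution M[x^n := N]  (raw operation)
subst1 : ℕ → ℕ → Tm → Tm → Tm
subst1 x n N (fv y m)  = if (y ≡ᵇ x) ∧ (m ≡ᵇ n) then N else fv y m
subst1 x n N (bv i m)  = bv i m
subst1 x n N (app M P) = app (subst1 x n N M) (subst1 x n N P)
subst1 x n N (lam m B) = lam m (subst1 x n N B)

data _▷β_ : Tm → Tm → Set where
  β-redex : ∀ {x n M N} → IsTerm M → IsTerm N → FV x n M → Joinable M N →
            deg N ≡ n → app (ƛ x n M) N ▷β subst1 x n N M
  β-lam   : ∀ {x n M M'} → M ▷β M' → FV x n M → FV x n M' → ƛ x n M ▷β ƛ x n M'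
  β-appˡ  : ∀ {M M' P} → M ▷β M' → IsTerm P → Joinable M P → Joinable M' P →
            app M P ▷β app M' P
  β-appʳ  : ∀ {M M' P} → M ▷β M' → IsTerm P → Joinable P M → Joinable P M' →
            app P M ▷β app P M'

_▷β*_ : Tm → Tm → Set
_▷β*_ = Star _▷β_

-- Types (raw syntax; the quotient is handled by the congruence _≈_)

data Ty : Set where
  atom : ℕ → Ty
  _⇒_  : Ty → Ty → Ty
  _⊓ᵗ_ : Ty → Ty → Ty
  ex   : ℕ → Ty → Ty

infixr 5 _⇒_
infixl 6 _⊓ᵗ_

data _≈_ : Ty → Ty → Set where
  ≈-refl  : ∀ {U} → U ≈ U
  ≈-sym   : ∀ {U V} → U ≈ V → V ≈ U
  ≈-trans : ∀ {U V W} → U ≈ V → V ≈ W → U ≈ W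
  ≈-comm  : ∀ {U V} → (U ⊓ᵗ V) ≈ (V ⊓ᵗ U)
  ≈-assoc : ∀ {U V W} → ((U ⊓ᵗ V) ⊓ᵗ W) ≈ (U ⊓ᵗ (V ⊓ᵗ W))
  ≈-idem  : ∀ {U} → (U ⊓ᵗ U) ≈ U
  ≈-distr : ∀ {e U V} → ex e (U ⊓ᵗ V) ≈ (ex e U ⊓ᵗ ex e V)
  ≈-⇒     : ∀ {U U' T T'} → U ≈ U' → T ≈ T' → (U ⇒ T) ≈ (U' ⇒ T')
  ≈-⊓     : ∀ {U U' V V'} → U ≈ U' → V ≈ V' → (U ⊓ᵗ V) ≈ (U' ⊓ᵗ V')
  ≈-ex    : ∀ {e U U'} → U ≈ U' → ex e U ≈ ex e U'

dT : Ty → ℕ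
dT (atom a) = 0
dT (U ⇒ T)  = dT U ⊓ dT T
dT (U ⊓ᵗ V) = dT U ⊓ dT V
dT (ex e U) = suc (dT U)

data GoodTy : Ty → Set where
  gt-atom : ∀ a → GoodTy (atom a)
  gt-ex   : ∀ {e U} → GoodTy U → GoodTy (ex e U)
  gt-⇒    : ∀ {U T} → GoodTy U → GoodTy T → dT T ≤ dT U → GoodTy (U ⇒ T)
  gt-⊓    : ∀ {U V} → GoodTy U → GoodTy V → dT U ≡ dT V → GoodTy (U ⊓ᵗ V)

mutual
  data IsU : Ty → Set where
    u-⊓ : ∀ {U V} → IsU U → IsU V → IsU (U ⊓ᵗ V)
    u-ex : ∀ {e U} → IsU U → IsU (ex e U)
    u-T  : ∀ {T} → IsT T → IsU T

  data IsT : Ty → Set where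
    t-atom : ∀ a → IsT (atom a)
    t-⇒    : ∀ {U T} → IsU U → IsT T → IsT (U ⇒ T)

Env : Set
Env = ℕ → ℕ → Maybe Ty

∅ : Env
∅ _ _ = nothing

-- Γ , x^n : U   (used only when x^n ∉ dom Γ)
extend : Env → ℕ → ℕ → Ty → Env
extend Γ x n U y m = if (y ≡ᵇ x) ∧ (m ≡ᵇ n) then just U else Γ y m

single : ℕ → ℕ → Ty → Env
single = extend ∅

InDom : Env → ℕ → ℕ → Set
InDom Γ x n = Σ Ty λ U → Γ x n ≡ just U

meetM : Maybe Ty → Maybe Ty → Maybe Ty
meetM (just U) (just V) = just (U ⊓ᵗ V)
meetM (just U) nothing  = just U
meetM nothing  v        = v

_⊓ₑ_ : Env → Env → Env
(Γ₁ ⊓ₑ Γ₂) y m = meetM (Γ₁ y m) (Γ₂ y m)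

expM : ℕ → Maybe Ty → Maybe Ty
expM e (just U) = just (ex e U)
expM e nothing  = nothing

eEnv : ℕ → Env → Env
eEnv e Γ y zero    = nothing
eEnv e Γ y (suc m) = expM e (Γ y m)

EnvJoin : Env → Env → Set
EnvJoin Γ₁ Γ₂ = ∀ x m n → InDom Γ₁ x m → InDom Γ₂ x n → m ≡ n

-- equality of environments (as sets of declarations, types up to ≈)
_≅_ : Env → Env → Set
Γ ≅ Γ' = ∀ x n → Pointwise _≈_ (Γ x n) (Γ' x n)

data _⊑_ : Ty → Ty → Set where
  ⊑-refl  : ∀ {U U'} → IsU U → U ≈ U' → U ⊑ U'
  ⊑-trans : ∀ {U V W} → U ⊑ V → V ⊑ W → U ⊑ W
  ⊑-elim  : ∀ {U₁ U₂} → IsU U₁ → IsU U₂ → GoodTy U₂ → dT U₁ ≡ dT U₂ →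
            (U₁ ⊓ᵗ U₂) ⊑ U₁
  ⊑-⊓     : ∀ {U₁ U₂ V₁ V₂} → U₁ ⊑ V₁ → U₂ ⊑ V₂ → (U₁ ⊓ᵗ U₂) ⊑ (V₁ ⊓ᵗ V₂)
  ⊑-⇒     : ∀ {U₁ U₂ T₁ T₂} → IsT T₁ → IsT T₂ → U₂ ⊑ U₁ → T₁ ⊑ T₂ →
            (U₁ ⇒ T₁) ⊑ (U₂ ⇒ T₂)
  ⊑-ex    : ∀ {e U₁ U₂} → U₁ ⊑ U₂ → ex e U₁ ⊑ ex e U₂

data _⊑ₑ_ : Env → Env → Set where
  ⊑ₑ-refl  : ∀ {Γ Γ'} → Γ ≅ Γ' → Γ ⊑ₑ Γ'
  ⊑ₑ-trans : ∀ {Γ Γ' Γ''} → Γ ⊑ₑ Γ' → Γ' ⊑ₑ Γ'' → Γ ⊑ₑ Γ''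
  ⊑ₑ-decl  : ∀ {Γ y n U₁ U₂} → Γ y n ≡ nothing → U₁ ⊑ U₂ →
             extend Γ y n U₁ ⊑ₑ extend Γ y n U₂

-- Typing systems ⊢₁ and ⊢₂.  Γ ⊢₁ M ∶ U  stands for  M : ⟨Γ ⊢₁ U⟩.
-- The rule 'conv' expresses that environments are sets and types are
-- taken modulo ≈.

data _⊢₁_∶_ : Env → Tm → Ty → Set where
  ax   : ∀ {x n T} → GoodTy T → dT T ≡ n → single x n T ⊢₁ fv x n ∶ T
  →I   : ∀ {Γ x n U M T} → Γ x n ≡ nothing → extend Γ x n U ⊢₁ M ∶ T →
         Γ ⊢₁ ƛ x n M ∶ (U ⇒ T)
  →E   : ∀ {Γ₁ Γ₂ M₁ M₂ U T} → Γ₁ ⊢₁ M₁ ∶ (U ⇒ T) → Γ₂ ⊢₁ M₂ ∶ U →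
         EnvJoin Γ₁ Γ₂ → (Γ₁ ⊓ₑ Γ₂) ⊢₁ app M₁ M₂ ∶ T
  ⊓I   : ∀ {Γ₁ Γ₂ M U₁ U₂} → Γ₁ ⊢₁ M ∶ U₁ → Γ₂ ⊢₁ M ∶ U₂ →
         (Γ₁ ⊓ₑ Γ₂) ⊢₁ M ∶ (U₁ ⊓ᵗ U₂)
  exp  : ∀ {Γ M U} e → Γ ⊢₁ M ∶ U → eEnv e Γ ⊢₁ plus M ∶ ex e U
  conv : ∀ {Γ Γ' M U U'} → Γ ⊢₁ M ∶ U → Γ ≅ Γ' → U ≈ U' → Γ' ⊢₁ M ∶ U'

data _⊢₂_∶_ : Env → Tm → Ty → Set where
  ax   : ∀ {x T} → IsT T → GoodTy T → single x 0 T ⊢₂ fv x 0 ∶ T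
  →I   : ∀ {Γ x n U M T} → IsU U → IsT T → Γ x n ≡ nothing →
         extend Γ x n U ⊢₂ M ∶ T → Γ ⊢₂ ƛ x n M ∶ (U ⇒ T)
  →E   : ∀ {Γ₁ Γ₂ M₁ M₂ U T} → IsU U → IsT T → Γ₁ ⊢₂ M₁ ∶ (U ⇒ T) →
         Γ₂ ⊢₂ M₂ ∶ U → EnvJoin Γ₁ Γ₂ → (Γ₁ ⊓ₑ Γ₂) ⊢₂ app M₁ M₂ ∶ T
  ⊓I   : ∀ {Γ₁ Γ₂ M U₁ U₂} → IsU U₁ → IsU U₂ → Γ₁ ⊢₂ M ∶ U₁ →
         Γ₂ ⊢₂ M ∶ U₂ → (Γ₁ ⊓ₑ Γ₂) ⊢₂ M ∶ (U₁ ⊓ᵗ U₂)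
  exp  : ∀ {Γ M U} e → IsU U → Γ ⊢₂ M ∶ U → eEnv e Γ ⊢₂ plus M ∶ ex e U
  sub  : ∀ {Γ Γ' M U U'} → Γ ⊢₂ M ∶ U → U ⊑ U' → Γ' ⊑ₑ Γ → Γ' ⊢₂ M ∶ U'
  conv : ∀ {Γ Γ' M U U'} → Γ ⊢₂ M ∶ U → Γ ≅ Γ' → U ≈ U' → Γ' ⊢₂ M ∶ U'

data Sys : Set where
  one two : Sys

_⊢[_]_∶_ : Env → Sys → Tm → Ty → Set
Γ ⊢[ one ] M ∶ U = Γ ⊢₁ M ∶ U
Γ ⊢[ two ] M ∶ U = Γ ⊢₂ M ∶ U

Saturated : (Tm → Set) → Set
Saturated X = ∀ M N → M ▷β* N → X N → X M

data Spine (x n : ℕ) : Tm → Set where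
  sp-var : Spine x n (fv x n)
  sp-app : ∀ {M N} → Spine x n M → Spine x n (app M N)

Neutral : ℕ → ℕ → Tm → Set
Neutral x n M = Spine x n M × Good M

record Interpretation : Set₁ where
  field
    I        : ℕ → Tm → Set
    sat      : ∀ a → Saturated (I a)
    neutral  : ∀ a x → V₁ x → ∀ M → Neutral x 0 M → I a M
    good     : ∀ a M → I a M → Good M × deg M ≡ 0
open Interpretation public

⟦_⟧ : Ty → Interpretation → Tm → Set
⟦ atom a ⟧ 𝓘 M = I 𝓘 a M
⟦ U ⇒ T ⟧  𝓘 M = IsTerm M × (∀ N → ⟦ U ⟧ 𝓘 N → Joinable M N → ⟦ T ⟧ 𝓘 (app M N))
⟦ U ⊓ᵗ V ⟧ 𝓘 M = ⟦ U ⟧ 𝓘 M × ⟦ V ⟧ 𝓘 M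
⟦ ex e U ⟧ 𝓘 M = Σ Tm λ P → ⟦ U ⟧ 𝓘 P × M ≡ plus P

Meaning : Ty → Tm → Set₁
Meaning U M = IsTerm M × Closed M × (∀ 𝓘 → ⟦ U ⟧ 𝓘 M)

lookupSubst : Env → (ℕ → ℕ → Tm) → ℕ → ℕ → Tm
lookupSubst Γ σ x n with Γ x n
... | just _  = σ x n
... | nothing = fv x n

substs : Env → (ℕ → ℕ → Tm) → Tm → Tm
substs Γ σ (fv x n)  = lookupSubst Γ σ x n
substs Γ σ (bv i n)  = bv i n
substs Γ σ (app M N) = app (substs Γ σ M) (substs Γ σ N)
substs Γ σ (lam n B) = lam n (substs Γ σ B)

-- definedness: M and all N_j pairwise joinable
SubstDefined : Env → (ℕ → ℕ → Tm) → Tm → Set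
SubstDefined Γ σ M =
  (∀ x n → InDom Γ x n → Joinable M (σ x n)) ×
  (∀ x n y m → InDom Γ x n → InDom Γ y m → Joinable (σ x n) (σ y m))

-- The proof is the classical realizability argument.  We first show that
-- every ⟦ U ⟧ 𝓘 is saturated; for the expansion case this needs that a
-- reduction ending in a lifted term P⁺ is itself the lift of a reduction,
-- which we obtain from the inverse operation M⁻ ("minus").  Next, for good
-- types, neutral terms x^{d(U)} N₁ … N_k inhabit ⟦ U ⟧ 𝓘 and every
-- inhabitant is a good term of degree d(U); this fixes the degree of an
-- argument so that β-redices may fire.  A typing invariant records that
-- typable terms are terms whose free variables are exactly the domain of
-- the environment, with good types of the right degrees.  The main
-- induction is stated for an arbitrary valuation v of all indexed
-- variables (the substitution 'instantiate v'); the abstraction case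
-- renames the bound variable to a fresh one and performs one β-step
-- backwards, using saturation.  The theorem lemma2 then follows by
-- choosing the valuation given by the substitution σ (resp. the identity).

module Submission where

open import Defs
open import Data.Nat using (ℕ; zero; suc; pred; _≤_; _⊓_; _⊔_; _≡ᵇ_; _*_; _+_; z≤n; s≤s)
open import Data.Nat.Properties
open import Data.Bool using (Bool; true; false; T; if_then_else_; _∧_)
open import Data.Unit using (tt)
open import Data.Maybe using (Maybe; just; nothing)
open import Data.Maybe.Properties using (just-injective)
import Data.Maybe.Relation.Binary.Pointwise as Pointwise
open import Data.Product using (Σ; _×_; _,_; proj₁; proj₂; map₁)
open import Data.Sum using (_⊎_; inj₁; inj₂) renaming (map₁ to ⊎-map₁)
open import Data.Sum.Function.Propositional using (_⊎-⇔_)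
open import Data.Empty using (⊥-elim)
open import Relation.Binary.PropositionalEquality
open import Relation.Binary.Construct.Closure.ReflexiveTransitive using (ε; _◅_)
open import Relation.Nullary using (¬_)
open import Function.Bundles using (_⇔_; mk⇔; Equivalence)
open import Function.Properties.Equivalence using (⇔-isEquivalence)
open import Relation.Binary.Structures using (IsEquivalence)
open import Level using (0ℓ)
open Equivalence using (to; from)
open IsEquivalence (⇔-isEquivalence {ℓ = 0ℓ}) using () renaming (refl to ⇔-refl; sym to ⇔-sym; trans to ⇔-trans)

-- Defs compares y^m with x^n by the boolean test
-- (y ≡ᵇ x) ∧ (m ≡ᵇ n); this view attaches its meaning to the outcome.
data Match (y m x n : ℕ) : Bool → Set where
  same  : y ≡ x → m ≡ n → Match y m x n true
  other : ¬ (y ≡ x × m ≡ n) → Match y m x n false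

match : ∀ y m x n → Match y m x n ((y ≡ᵇ x) ∧ (m ≡ᵇ n))
match y m x n with y ≡ᵇ x in y≡ᵇx | m ≡ᵇ n in m≡ᵇn
... | true  | true  = same (≡ᵇ⇒≡ y x (subst T (sym y≡ᵇx) tt)) (≡ᵇ⇒≡ m n (subst T (sym m≡ᵇn) tt))
... | true  | false = other λ (_ , m≡n) → subst T m≡ᵇn (≡⇒≡ᵇ m n m≡n)
... | false | _     = other λ (y≡x , _) → subst T y≡ᵇx (≡⇒≡ᵇ y x y≡x)

if-same : ∀ {A : Set} x n (a b : A) → (if (x ≡ᵇ x) ∧ (n ≡ᵇ n) then a else b) ≡ a
if-same x n a b with (x ≡ᵇ x) ∧ (n ≡ᵇ n) | match x n x n
... | true  | _        = refl
... | false | other ne = ⊥-elim (ne (refl , refl))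

if-other : ∀ {A : Set} y m x n (a b : A) → ¬ (y ≡ x × m ≡ n) →
           (if (y ≡ᵇ x) ∧ (m ≡ᵇ n) then a else b) ≡ b
if-other y m x n a b ne with (y ≡ᵇ x) ∧ (m ≡ᵇ n) | match y m x n
... | true  | same y≡x m≡n = ⊥-elim (ne (y≡x , m≡n))
... | false | _            = refl

FV-closeAt⁻ : ∀ {y m} k x n M → FV y m (closeAt k x n M) → FV y m M × ¬ (y ≡ x × m ≡ n)
FV-closeAt⁻ k x n (fv y m) p with (y ≡ᵇ x) ∧ (m ≡ᵇ n) | match y m x n
FV-closeAt⁻ k x n (fv y m) ()     | true  | _
FV-closeAt⁻ k x n (fv y m) fv-var | false | other ne = fv-var , ne
FV-closeAt⁻ k x n (app M N) (fv-appˡ p) = map₁ fv-appˡ (FV-closeAt⁻ k x n M p)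
FV-closeAt⁻ k x n (app M N) (fv-appʳ p) = map₁ fv-appʳ (FV-closeAt⁻ k x n N p)
FV-closeAt⁻ k x n (lam m B) (fv-lam p)  = map₁ fv-lam (FV-closeAt⁻ (suc k) x n B p)

FV-closeAt⁺ : ∀ {y m} k x n M → FV y m M → ¬ (y ≡ x × m ≡ n) → FV y m (closeAt k x n M)
FV-closeAt⁺ {y} {m} k x n (fv y m) fv-var ne rewrite if-other y m x n (bv k n) (fv y m) ne = fv-var
FV-closeAt⁺ k x n (app M N) (fv-appˡ p) ne = fv-appˡ (FV-closeAt⁺ k x n M p ne)
FV-closeAt⁺ k x n (app M N) (fv-appʳ p) ne = fv-appʳ (FV-closeAt⁺ k x n N p ne)
FV-closeAt⁺ k x n (lam m B) (fv-lam p)  ne = fv-lam (FV-closeAt⁺ (suc k) x n B p ne)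

FV-ƛ⁻ : ∀ {x n y m M} → FV y m (ƛ x n M) → FV y m M × ¬ (y ≡ x × m ≡ n)
FV-ƛ⁻ {x} {n} {M = M} (fv-lam p) = FV-closeAt⁻ 0 x n M p

FV-ƛ⁺ : ∀ {x n y m M} → FV y m M → ¬ (y ≡ x × m ≡ n) → FV y m (ƛ x n M)
FV-ƛ⁺ {x} {n} {M = M} p ne = fv-lam (FV-closeAt⁺ 0 x n M p ne)

FV-subst1⁻ : ∀ {y m} x n N M → FV y m (subst1 x n N M) → (FV y m M × ¬ (y ≡ x × m ≡ n)) ⊎ FV y m N
FV-subst1⁻ x n N (fv y m) p with (y ≡ᵇ x) ∧ (m ≡ᵇ n) | match y m x n
FV-subst1⁻ x n N (fv y m) p      | true  | _        = inj₂ p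
FV-subst1⁻ x n N (fv y m) fv-var | false | other ne = inj₁ (fv-var , ne)
FV-subst1⁻ x n N (app M P) (fv-appˡ p) = ⊎-map₁ (map₁ fv-appˡ) (FV-subst1⁻ x n N M p)
FV-subst1⁻ x n N (app M P) (fv-appʳ p) = ⊎-map₁ (map₁ fv-appʳ) (FV-subst1⁻ x n N P p)
FV-subst1⁻ x n N (lam m B) (fv-lam p)  = ⊎-map₁ (map₁ fv-lam) (FV-subst1⁻ x n N B p)

FV→deg : ∀ {x n M} → FV x n M → deg M ≤ n
FV→deg fv-var = ≤-refl
FV→deg {M = app M N} (fv-appˡ p) = ≤-trans (m⊓n≤m (deg M) (deg N)) (FV→deg p)
FV→deg {M = app M N} (fv-appʳ p) = ≤-trans (m⊓n≤n (deg M) (deg N)) (FV→deg p)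
FV→deg (fv-lam p) = FV→deg p

deg-closeAt : ∀ k x n M → deg (closeAt k x n M) ≡ deg M
deg-closeAt k x n (fv y m) with (y ≡ᵇ x) ∧ (m ≡ᵇ n) | match y m x n
... | true  | same _ m≡n = sym m≡n
... | false | _          = refl
deg-closeAt k x n (bv i m)  = refl
deg-closeAt k x n (app M N) = cong₂ _⊓_ (deg-closeAt k x n M) (deg-closeAt k x n N)
deg-closeAt k x n (lam m B) = deg-closeAt (suc k) x n B

⊓-≡ˡ : ∀ {a b} → a ≡ b → a ⊓ b ≡ a
⊓-≡ˡ a≡b = m≤n⇒m⊓n≡m (≤-reflexive a≡b)

⊓-≡ʳ : ∀ {a b} → a ≡ b → a ⊓ b ≡ b
⊓-≡ʳ a≡b = m≥n⇒m⊓n≡n (≤-reflexive (sym a≡b))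

deg-plus : ∀ M → deg (plus M) ≡ suc (deg M)
deg-plus (fv x n)  = refl
deg-plus (bv i n)  = refl
deg-plus (app M N) = cong₂ _⊓_ (deg-plus M) (deg-plus N)
deg-plus (lam n B) = deg-plus B

FV-plus⁺ : ∀ {y k M} → FV y k M → FV y (suc k) (plus M)
FV-plus⁺ fv-var      = fv-var
FV-plus⁺ (fv-appˡ p) = fv-appˡ (FV-plus⁺ p)
FV-plus⁺ (fv-appʳ p) = fv-appʳ (FV-plus⁺ p)
FV-plus⁺ (fv-lam p)  = fv-lam (FV-plus⁺ p)

FV-plus⁻ : ∀ {y k} M → FV y k (plus M) → Σ ℕ λ k' → k ≡ suc k' × FV y k' M
FV-plus⁻ (fv x n)  fv-var      = n , refl , fv-var
FV-plus⁻ (app M N) (fv-appˡ p) = let (k' , e , q) = FV-plus⁻ M p in k' , e , fv-appˡ q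
FV-plus⁻ (app M N) (fv-appʳ p) = let (k' , e , q) = FV-plus⁻ N p in k' , e , fv-appʳ q
FV-plus⁻ (lam n B) (fv-lam p)  = let (k' , e , q) = FV-plus⁻ B p in k' , e , fv-lam q

plus-closeAt : ∀ k x n M → plus (closeAt k x n M) ≡ closeAt k x (suc n) (plus M)
plus-closeAt k x n (fv y m) with (y ≡ᵇ x) ∧ (m ≡ᵇ n)
... | true  = refl
... | false = refl
plus-closeAt k x n (bv i m)  = refl
plus-closeAt k x n (app M N) = cong₂ app (plus-closeAt k x n M) (plus-closeAt k x n N)
plus-closeAt k x n (lam m B) = cong (lam (suc m)) (plus-closeAt (suc k) x n B)

plus-ƛ : ∀ x n M → plus (ƛ x n M) ≡ ƛ x (suc n) (plus M)
plus-ƛ x n M = cong (lam (suc n)) (plus-closeAt 0 x n M)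

Joinable-plus : ∀ {M N} → Joinable M N → Joinable (plus M) (plus N)
Joinable-plus {M} {N} M◇N x m n p q with FV-plus⁻ M p | FV-plus⁻ N q
... | m' , refl , p' | n' , refl , q' = cong suc (M◇N x m' n' p' q')

Joinable-plus⁻ : ∀ {M N} → Joinable (plus M) (plus N) → Joinable M N
Joinable-plus⁻ M⁺◇N⁺ x m n p q = suc-injective (M⁺◇N⁺ x (suc m) (suc n) (FV-plus⁺ p) (FV-plus⁺ q))

IsTerm-plus : ∀ {M} → IsTerm M → IsTerm (plus M)
IsTerm-plus (t-var x n)     = t-var x (suc n)
IsTerm-plus (t-app a b M◇N) = t-app (IsTerm-plus a) (IsTerm-plus b) (Joinable-plus M◇N)
IsTerm-plus (t-lam {x} {n} {M} a p) = subst IsTerm (sym (plus-ƛ x n M)) (t-lam (IsTerm-plus a) (FV-plus⁺ p))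

Good-plus : ∀ {M} → Good M → Good (plus M)
Good-plus (g-var x n) = g-var x (suc n)
Good-plus (g-app {M} {N} a b M◇N dM≤dN) =
  g-app (Good-plus a) (Good-plus b) (Joinable-plus M◇N)
        (subst₂ _≤_ (sym (deg-plus M)) (sym (deg-plus N)) (s≤s dM≤dN))
Good-plus (g-lam {x} {n} {M} a p) = subst Good (sym (plus-ƛ x n M)) (g-lam (Good-plus a) (FV-plus⁺ p))

Good→IsTerm : ∀ {M} → Good M → IsTerm M
Good→IsTerm (g-var x n)       = t-var x n
Good→IsTerm (g-app a b M◇N _) = t-app (Good→IsTerm a) (Good→IsTerm b) M◇N
Good→IsTerm (g-lam a p)       = t-lam (Good→IsTerm a) p

-- Lowering M ↦ M⁻ is the inverse of lifting on terms all of whose indices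
-- are positive; it is used to invert lifting on terms and reductions.
Positive : Tm → Set
Positive (fv x n)  = 1 ≤ n
Positive (bv i n)  = 1 ≤ n
Positive (app M N) = Positive M × Positive N
Positive (lam n B) = 1 ≤ n × Positive B

minus : Tm → Tm
minus (fv x n)  = fv x (pred n)
minus (bv i n)  = bv i (pred n)
minus (app M N) = app (minus M) (minus N)
minus (lam n B) = lam (pred n) (minus B)

minus-plus : ∀ M → minus (plus M) ≡ M
minus-plus (fv x n)  = refl
minus-plus (bv i n)  = refl
minus-plus (app M N) = cong₂ app (minus-plus M) (minus-plus N)
minus-plus (lam n B) = cong (lam n) (minus-plus B)

plus-minus : ∀ M → Positive M → plus (minus M) ≡ M
plus-minus (fv x (suc n))   _       = refl
plus-minus (bv i (suc n))   _       = refl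
plus-minus (app M N)        (a , b) = cong₂ app (plus-minus M a) (plus-minus N b)
plus-minus (lam (suc n) B)  (_ , b) = cong (lam (suc n)) (plus-minus B b)

plus-injective : ∀ {M N} → plus M ≡ plus N → M ≡ N
plus-injective {M} {N} M⁺≡N⁺ = trans (sym (minus-plus M)) (trans (cong minus M⁺≡N⁺) (minus-plus N))

Positive-plus : ∀ M → Positive (plus M)
Positive-plus (fv x n)  = s≤s z≤n
Positive-plus (bv i n)  = s≤s z≤n
Positive-plus (app M N) = Positive-plus M , Positive-plus N
Positive-plus (lam n B) = s≤s z≤n , Positive-plus B

Positive-closeAt⁻ : ∀ k x n M → Positive (closeAt k x n M) → Positive M
Positive-closeAt⁻ k x n (fv y m) h with (y ≡ᵇ x) ∧ (m ≡ᵇ n) | match y m x n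
... | true  | same _ m≡n = subst (1 ≤_) (sym m≡n) h
... | false | _          = h
Positive-closeAt⁻ k x n (bv i m)  h       = h
Positive-closeAt⁻ k x n (app M N) (a , b) = Positive-closeAt⁻ k x n M a , Positive-closeAt⁻ k x n N b
Positive-closeAt⁻ k x n (lam m B) (a , b) = a , Positive-closeAt⁻ (suc k) x n B b

Positive-closeAt⁺ : ∀ k x n M → Positive M → Positive (closeAt k x n M)
Positive-closeAt⁺ k x n (fv y m) h with (y ≡ᵇ x) ∧ (m ≡ᵇ n) | match y m x n
... | true  | same _ m≡n = subst (1 ≤_) m≡n h
... | false | _          = h
Positive-closeAt⁺ k x n (bv i m)  h       = h
Positive-closeAt⁺ k x n (app M N) (a , b) = Positive-closeAt⁺ k x n M a , Positive-closeAt⁺ k x n N b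
Positive-closeAt⁺ k x n (lam m B) (a , b) = a , Positive-closeAt⁺ (suc k) x n B b

Positive-subst1-body : ∀ x n N M → 1 ≤ n → Positive (subst1 x n N M) → Positive M
Positive-subst1-body x n N (fv y m) n≥1 h with (y ≡ᵇ x) ∧ (m ≡ᵇ n) | match y m x n
... | true  | same _ m≡n = subst (1 ≤_) (sym m≡n) n≥1
... | false | _          = h
Positive-subst1-body x n N (bv i m)  n≥1 h       = h
Positive-subst1-body x n N (app M P) n≥1 (a , b) = Positive-subst1-body x n N M n≥1 a , Positive-subst1-body x n N P n≥1 b
Positive-subst1-body x n N (lam m B) n≥1 (a , b) = a , Positive-subst1-body x n N B n≥1 b

Positive-subst1-arg : ∀ x n N M → FV x n M → Positive (subst1 x n N M) → Positive N
Positive-subst1-arg x n N (fv x n) fv-var h rewrite if-same x n N (fv x n) = h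
Positive-subst1-arg x n N (app M P) (fv-appˡ p) (a , _) = Positive-subst1-arg x n N M p a
Positive-subst1-arg x n N (app M P) (fv-appʳ p) (_ , b) = Positive-subst1-arg x n N P p b
Positive-subst1-arg x n N (lam m B) (fv-lam p)  (_ , b) = Positive-subst1-arg x n N B p b

Positive→deg : ∀ M → Positive M → 1 ≤ deg M
Positive→deg (fv x n)  h       = h
Positive→deg (bv i n)  h       = h
Positive→deg (app M N) (a , b) = ⊓-glb (Positive→deg M a) (Positive→deg N b)
Positive→deg (lam n B) (_ , b) = Positive→deg B b

deg→Positive : ∀ {M} → IsTerm M → 1 ≤ deg M → Positive M
deg→Positive (t-var x n) h = h
deg→Positive (t-app {M} {N} a b _) h =
  deg→Positive a (≤-trans h (m⊓n≤m (deg M) (deg N))) , deg→Positive b (≤-trans h (m⊓n≤n (deg M) (deg N)))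
deg→Positive (t-lam {x} {n} {M} a p) h =
  let dM≥1 = subst (1 ≤_) (deg-closeAt 0 x n M) h in
  ≤-trans dM≥1 (FV→deg p) , Positive-closeAt⁺ 0 x n M (deg→Positive a dM≥1)

minus-closeAt : ∀ k x n M → 1 ≤ n → Positive M → minus (closeAt k x n M) ≡ closeAt k x (pred n) (minus M)
minus-closeAt k x (suc n) (fv y (suc m)) _ _ with (y ≡ᵇ x) ∧ (m ≡ᵇ n)
... | true  = refl
... | false = refl
minus-closeAt k x n (bv i m)  _   _       = refl
minus-closeAt k x n (app M N) n≥1 (a , b) = cong₂ app (minus-closeAt k x n M n≥1 a) (minus-closeAt k x n N n≥1 b)
minus-closeAt k x n (lam m B) n≥1 (_ , b) = cong (lam (pred m)) (minus-closeAt (suc k) x n B n≥1 b)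

minus-ƛ : ∀ x n M → 1 ≤ n → Positive M → minus (ƛ x n M) ≡ ƛ x (pred n) (minus M)
minus-ƛ x n M n≥1 h = cong (lam (pred n)) (minus-closeAt 0 x n M n≥1 h)

minus-subst1 : ∀ x n N M → 1 ≤ n → Positive M → minus (subst1 x n N M) ≡ subst1 x (pred n) (minus N) (minus M)
minus-subst1 x (suc n) N (fv y (suc m)) _ _ with (y ≡ᵇ x) ∧ (m ≡ᵇ n)
... | true  = refl
... | false = refl
minus-subst1 x n N (bv i m)  _   _       = refl
minus-subst1 x n N (app M P) n≥1 (a , b) = cong₂ app (minus-subst1 x n N M n≥1 a) (minus-subst1 x n N P n≥1 b)
minus-subst1 x n N (lam m B) n≥1 (_ , b) = cong (lam (pred m)) (minus-subst1 x n N B n≥1 b)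

pred-⊓ : ∀ a b → pred (a ⊓ b) ≡ pred a ⊓ pred b
pred-⊓ zero    b       = refl
pred-⊓ (suc a) zero    = sym (⊓-zeroʳ a)
pred-⊓ (suc a) (suc b) = refl

deg-minus : ∀ M → deg (minus M) ≡ pred (deg M)
deg-minus (fv x n)  = refl
deg-minus (bv i n)  = refl
deg-minus (app M N) = trans (cong₂ _⊓_ (deg-minus M) (deg-minus N)) (sym (pred-⊓ (deg M) (deg N)))
deg-minus (lam n B) = deg-minus B

FV-minus⁺ : ∀ {y m M} → FV y m M → FV y (pred m) (minus M)
FV-minus⁺ fv-var      = fv-var
FV-minus⁺ (fv-appˡ p) = fv-appˡ (FV-minus⁺ p)
FV-minus⁺ (fv-appʳ p) = fv-appʳ (FV-minus⁺ p)
FV-minus⁺ (fv-lam p)  = fv-lam (FV-minus⁺ p)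

FV-minus⁻ : ∀ {y k} M → Positive M → FV y k (minus M) → FV y (suc k) M
FV-minus⁻ (fv x (suc n)) _       fv-var      = fv-var
FV-minus⁻ (app M N)      (a , _) (fv-appˡ p) = fv-appˡ (FV-minus⁻ M a p)
FV-minus⁻ (app M N)      (_ , b) (fv-appʳ p) = fv-appʳ (FV-minus⁻ N b p)
FV-minus⁻ (lam n B)      (_ , b) (fv-lam p)  = fv-lam (FV-minus⁻ B b p)

Joinable-minus : ∀ {M N} → Positive M → Positive N → Joinable M N → Joinable (minus M) (minus N)
Joinable-minus {M} {N} a b M◇N x m n p q =
  suc-injective (M◇N x (suc m) (suc n) (FV-minus⁻ M a p) (FV-minus⁻ N b q))

IsTerm-minus : ∀ {M} → IsTerm M → Positive M → IsTerm (minus M)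
IsTerm-minus (t-var x n)     _       = t-var x (pred n)
IsTerm-minus (t-app a b M◇N) (α , β) = t-app (IsTerm-minus a α) (IsTerm-minus b β) (Joinable-minus α β M◇N)
IsTerm-minus (t-lam {x} {n} {M} a p) (n≥1 , h) =
  let hM = Positive-closeAt⁻ 0 x n M h in
  subst IsTerm (sym (minus-ƛ x n M n≥1 hM)) (t-lam (IsTerm-minus a hM) (FV-minus⁺ p))

Good-minus : ∀ {M} → Good M → Positive M → Good (minus M)
Good-minus (g-var x n) _ = g-var x (pred n)
Good-minus (g-app {M} {N} a b M◇N dM≤dN) (α , β) =
  g-app (Good-minus a α) (Good-minus b β) (Joinable-minus α β M◇N)
        (subst₂ _≤_ (sym (deg-minus M)) (sym (deg-minus N)) (pred-mono-≤ dM≤dN))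
Good-minus (g-lam {x} {n} {M} a p) (n≥1 , h) =
  let hM = Positive-closeAt⁻ 0 x n M h in
  subst Good (sym (minus-ƛ x n M n≥1 hM)) (g-lam (Good-minus a hM) (FV-minus⁺ p))

minus-step : ∀ {M M'} → M ▷β M' → Positive M' → Positive M × (minus M ▷β minus M')
minus-step (β-redex {x} {n} {B} {N} iB iN p B◇N dN≡n) h =
  ((n≥1 , Positive-closeAt⁺ 0 x n B hB) , hN) ,
  subst₂ _▷β_ (sym (cong₂ app (minus-ƛ x n B n≥1 hB) refl)) (sym (minus-subst1 x n N B n≥1 hB))
    (β-redex (IsTerm-minus iB hB) (IsTerm-minus iN hN) (FV-minus⁺ p) (Joinable-minus hB hN B◇N)
             (trans (deg-minus N) (cong pred dN≡n)))
  where
    hN  = Positive-subst1-arg x n N B p h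
    n≥1 = subst (1 ≤_) dN≡n (Positive→deg N hN)
    hB  = Positive-subst1-body x n N B n≥1 h
minus-step (β-lam {x} {n} {M} {M'} s p p') (n≥1 , h) =
  let hM' = Positive-closeAt⁻ 0 x n M' h
      (hM , s⁻) = minus-step s hM' in
  (n≥1 , Positive-closeAt⁺ 0 x n M hM) ,
  subst₂ _▷β_ (sym (minus-ƛ x n M n≥1 hM)) (sym (minus-ƛ x n M' n≥1 hM'))
    (β-lam s⁻ (FV-minus⁺ p) (FV-minus⁺ p'))
minus-step (β-appˡ s iP j j') (hM' , hP) =
  let (hM , s⁻) = minus-step s hM' in
  (hM , hP) , β-appˡ s⁻ (IsTerm-minus iP hP) (Joinable-minus hM hP j) (Joinable-minus hM' hP j')
minus-step (β-appʳ s iP j j') (hP , hM') =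
  let (hM , s⁻) = minus-step s hM' in
  (hP , hM) , β-appʳ s⁻ (IsTerm-minus iP hP) (Joinable-minus hP hM j) (Joinable-minus hP hM' j')

▷β*-unlift : ∀ {M P} → M ▷β* plus P → Σ Tm λ Q → M ≡ plus Q × Q ▷β* P
▷β*-unlift {M} {P} r = let (hM , r⁻) = lower r in minus M , sym (plus-minus M hM) , r⁻
  where
    lower : ∀ {M} → M ▷β* plus P → Positive M × minus M ▷β* P
    lower ε = Positive-plus P , subst (_▷β* P) (sym (minus-plus P)) ε
    lower (s ◅ r) = let (h , r⁻) = lower r ; (h' , s⁻) = minus-step s h in h' , s⁻ ◅ r⁻

Joinable-sym : ∀ {M N} → Joinable M N → Joinable N M
Joinable-sym M◇N x m n p q = sym (M◇N x n m q p)

-- A term is joinable with itself: each name occurs with one index only.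
Joinable-self : ∀ {M} → IsTerm M → Joinable M M
Joinable-self (t-var x n) y m k fv-var fv-var = refl
Joinable-self (t-app a b M◇N) y m k (fv-appˡ p) (fv-appˡ q) = Joinable-self a y m k p q
Joinable-self (t-app a b M◇N) y m k (fv-appˡ p) (fv-appʳ q) = M◇N y m k p q
Joinable-self (t-app a b M◇N) y m k (fv-appʳ p) (fv-appˡ q) = sym (M◇N y k m q p)
Joinable-self (t-app a b M◇N) y m k (fv-appʳ p) (fv-appʳ q) = Joinable-self b y m k p q
Joinable-self (t-lam a _) y m k p q = Joinable-self a y m k (proj₁ (FV-ƛ⁻ p)) (proj₁ (FV-ƛ⁻ q))

Joinable-ƛ : ∀ {x n M N} → Joinable M N → Joinable (ƛ x n M) N
Joinable-ƛ M◇N y m k p q = M◇N y m k (proj₁ (FV-ƛ⁻ p)) q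

▷β-IsTerm : ∀ {M M'} → M ▷β M' → IsTerm M
▷β-IsTerm (β-redex iB iN p B◇N _) = t-app (t-lam iB p) iN (Joinable-ƛ B◇N)
▷β-IsTerm (β-lam s p _)           = t-lam (▷β-IsTerm s) p
▷β-IsTerm (β-appˡ s iP j _)       = t-app (▷β-IsTerm s) iP j
▷β-IsTerm (β-appʳ s iP j _)       = t-app iP (▷β-IsTerm s) j

▷β-FV : ∀ {M M' y m} → M ▷β M' → FV y m M' → FV y m M
▷β-FV (β-redex {x} {n} {B} {N} _ _ _ _ _) q with FV-subst1⁻ x n N B q
... | inj₁ (q' , ne) = fv-appˡ (FV-ƛ⁺ q' ne)
... | inj₂ q'        = fv-appʳ q'
▷β-FV (β-lam s _ _) q = let (q' , ne) = FV-ƛ⁻ q in FV-ƛ⁺ (▷β-FV s q') ne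
▷β-FV (β-appˡ s _ _ _) (fv-appˡ q) = fv-appˡ (▷β-FV s q)
▷β-FV (β-appˡ s _ _ _) (fv-appʳ q) = fv-appʳ q
▷β-FV (β-appʳ s _ _ _) (fv-appˡ q) = fv-appˡ q
▷β-FV (β-appʳ s _ _ _) (fv-appʳ q) = fv-appʳ (▷β-FV s q)

Joinable-▷β : ∀ {M M' P} → M ▷β M' → Joinable M P → Joinable M' P
Joinable-▷β s M◇P x m n p q = M◇P x m n (▷β-FV s p) q

▷β*-appˡ : ∀ {M M' P} → M ▷β* M' → IsTerm P → Joinable M P → app M P ▷β* app M' P
▷β*-appˡ ε        iP M◇P = ε
▷β*-appˡ (s ◅ r) iP M◇P = β-appˡ s iP M◇P M'◇P ◅ ▷β*-appˡ r iP M'◇P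
  where M'◇P = Joinable-▷β s M◇P

Joinable-▷β* : ∀ {M M' P} → M ▷β* M' → Joinable M P → Joinable M' P
Joinable-▷β* ε       M◇P = M◇P
Joinable-▷β* (s ◅ r) M◇P = Joinable-▷β* r (Joinable-▷β s M◇P)

⟦⟧-IsTerm : ∀ U 𝓘 M → ⟦ U ⟧ 𝓘 M → IsTerm M
⟦⟧-IsTerm (atom a) 𝓘 M h                = Good→IsTerm (proj₁ (good 𝓘 a M h))
⟦⟧-IsTerm (U ⇒ T)  𝓘 M (iM , _)         = iM
⟦⟧-IsTerm (U ⊓ᵗ V) 𝓘 M (h , _)          = ⟦⟧-IsTerm U 𝓘 M h
⟦⟧-IsTerm (ex e U) 𝓘 _ (P , h , refl)   = IsTerm-plus (⟦⟧-IsTerm U 𝓘 P h)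

⟦⟧-saturated : ∀ U 𝓘 → Saturated (⟦ U ⟧ 𝓘)
⟦⟧-saturated (atom a) 𝓘 M N r h = sat 𝓘 a M N r h
⟦⟧-saturated (U ⇒ T)  𝓘 M N r (iN , f) = source-IsTerm r , λ P hP M◇P →
  ⟦⟧-saturated T 𝓘 (app M P) (app N P) (▷β*-appˡ r (⟦⟧-IsTerm U 𝓘 P hP) M◇P)
               (f P hP (Joinable-▷β* r M◇P))
  where
    source-IsTerm : ∀ {M} → M ▷β* N → IsTerm M
    source-IsTerm ε       = iN
    source-IsTerm (s ◅ _) = ▷β-IsTerm s
⟦⟧-saturated (U ⊓ᵗ V) 𝓘 M N r (hU , hV) = ⟦⟧-saturated U 𝓘 M N r hU , ⟦⟧-saturated V 𝓘 M N r hV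
⟦⟧-saturated (ex e U) 𝓘 M _ r (P , h , refl) =
  let (Q , M≡Q⁺ , Q▷P) = ▷β*-unlift r in Q , ⟦⟧-saturated U 𝓘 Q P Q▷P h , M≡Q⁺

≈-dT : ∀ {U V} → U ≈ V → dT U ≡ dT V
≈-dT ≈-refl                   = refl
≈-dT (≈-sym p)                = sym (≈-dT p)
≈-dT (≈-trans p q)            = trans (≈-dT p) (≈-dT q)
≈-dT (≈-comm {U} {V})         = ⊓-comm (dT U) (dT V)
≈-dT (≈-assoc {U} {V} {W})    = ⊓-assoc (dT U) (dT V) (dT W)
≈-dT (≈-idem {U})             = ⊓-idem (dT U)
≈-dT ≈-distr                  = refl
≈-dT (≈-⇒ p q)                = cong₂ _⊓_ (≈-dT p) (≈-dT q)
≈-dT (≈-⊓ p q)                = cong₂ _⊓_ (≈-dT p) (≈-dT q)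
≈-dT (≈-ex p)                 = cong suc (≈-dT p)

≈-good : ∀ {U V} → U ≈ V → GoodTy U ⇔ GoodTy V
≈-good ≈-refl        = ⇔-refl
≈-good (≈-sym p)     = ⇔-sym (≈-good p)
≈-good (≈-trans p q) = ⇔-trans (≈-good p) (≈-good q)
≈-good ≈-comm        = mk⇔ swap swap
  where swap : ∀ {U V} → GoodTy (U ⊓ᵗ V) → GoodTy (V ⊓ᵗ U)
        swap (gt-⊓ a b e) = gt-⊓ b a (sym e)
≈-good ≈-assoc = mk⇔
  (λ { (gt-⊓ (gt-⊓ a b e₁) c e₂) → let e₃ = trans (sym (⊓-≡ʳ e₁)) e₂ in
                                    gt-⊓ a (gt-⊓ b c e₃) (trans e₁ (sym (⊓-≡ˡ e₃))) })
  (λ { (gt-⊓ a (gt-⊓ b c e₃) e₄) → let e₁ = trans e₄ (⊓-≡ˡ e₃) in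
                                    gt-⊓ (gt-⊓ a b e₁) c (trans (⊓-≡ʳ e₁) e₃) })
≈-good ≈-idem  = mk⇔ (λ { (gt-⊓ a _ _) → a }) (λ a → gt-⊓ a a refl)
≈-good ≈-distr = mk⇔ (λ { (gt-ex (gt-⊓ a b e)) → gt-⊓ (gt-ex a) (gt-ex b) (cong suc e) })
                     (λ { (gt-⊓ (gt-ex a) (gt-ex b) e) → gt-ex (gt-⊓ a b (suc-injective e)) })
≈-good (≈-⇒ p q) = mk⇔
  (λ { (gt-⇒ a b le) → gt-⇒ (to (≈-good p) a) (to (≈-good q) b) (subst₂ _≤_ (≈-dT q) (≈-dT p) le) })
  (λ { (gt-⇒ a b le) → gt-⇒ (from (≈-good p) a) (from (≈-good q) b)
                              (subst₂ _≤_ (sym (≈-dT q)) (sym (≈-dT p)) le) })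
≈-good (≈-⊓ p q) = mk⇔
  (λ { (gt-⊓ a b e) → gt-⊓ (to (≈-good p) a) (to (≈-good q) b) (trans (sym (≈-dT p)) (trans e (≈-dT q))) })
  (λ { (gt-⊓ a b e) → gt-⊓ (from (≈-good p) a) (from (≈-good q) b) (trans (≈-dT p) (trans e (sym (≈-dT q)))) })
≈-good (≈-ex p) = mk⇔ (λ { (gt-ex a) → gt-ex (to (≈-good p) a) }) (λ { (gt-ex a) → gt-ex (from (≈-good p) a) })

≈-sem : ∀ {U V} → U ≈ V → ∀ 𝓘 M → ⟦ U ⟧ 𝓘 M ⇔ ⟦ V ⟧ 𝓘 M
≈-sem ≈-refl        𝓘 M = ⇔-refl
≈-sem (≈-sym p)     𝓘 M = ⇔-sym (≈-sem p 𝓘 M)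
≈-sem (≈-trans p q) 𝓘 M = ⇔-trans (≈-sem p 𝓘 M) (≈-sem q 𝓘 M)
≈-sem ≈-comm        𝓘 M = mk⇔ (λ (a , b) → b , a) (λ (a , b) → b , a)
≈-sem ≈-assoc       𝓘 M = mk⇔ (λ ((a , b) , c) → a , (b , c)) (λ (a , (b , c)) → (a , b) , c)
≈-sem ≈-idem        𝓘 M = mk⇔ proj₁ (λ a → a , a)
≈-sem (≈-distr {e} {U} {V}) 𝓘 M = mk⇔
  (λ (P , (u , v) , M≡P⁺) → (P , u , M≡P⁺) , (P , v , M≡P⁺))
  (λ ((P , u , M≡P⁺) , (P' , v , M≡P'⁺)) →
     P , (u , subst (⟦ V ⟧ 𝓘) (plus-injective (trans (sym M≡P'⁺) M≡P⁺)) v) , M≡P⁺)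
≈-sem (≈-⇒ p q) 𝓘 M = mk⇔
  (λ (iM , f) → iM , λ N h M◇N → to (≈-sem q 𝓘 _) (f N (from (≈-sem p 𝓘 N) h) M◇N))
  (λ (iM , f) → iM , λ N h M◇N → from (≈-sem q 𝓘 _) (f N (to (≈-sem p 𝓘 N) h) M◇N))
≈-sem (≈-⊓ p q) 𝓘 M = mk⇔
  (λ (a , b) → to (≈-sem p 𝓘 M) a , to (≈-sem q 𝓘 M) b)
  (λ (a , b) → from (≈-sem p 𝓘 M) a , from (≈-sem q 𝓘 M) b)
≈-sem (≈-ex p) 𝓘 M = mk⇔
  (λ (P , h , M≡P⁺) → P , to (≈-sem p 𝓘 P) h , M≡P⁺)
  (λ (P , h , M≡P⁺) → P , from (≈-sem p 𝓘 P) h , M≡P⁺)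

IsT-dT : ∀ {T} → IsT T → dT T ≡ 0
IsT-dT (t-atom a)        = refl
IsT-dT (t-⇒ {U} _ isT)   = trans (cong (dT U ⊓_) (IsT-dT isT)) (⊓-zeroʳ (dT U))

dT-⇒ : ∀ U {T} → IsT T → dT (U ⇒ T) ≡ 0
dT-⇒ U isT = trans (cong (dT U ⊓_) (IsT-dT isT)) (⊓-zeroʳ (dT U))

⊑-dT : ∀ {U V} → U ⊑ V → dT U ≡ dT V
⊑-dT (⊑-refl _ p)        = ≈-dT p
⊑-dT (⊑-trans p q)       = trans (⊑-dT p) (⊑-dT q)
⊑-dT (⊑-elim _ _ _ e)    = ⊓-≡ˡ e
⊑-dT (⊑-⊓ p q)           = cong₂ _⊓_ (⊑-dT p) (⊑-dT q)
⊑-dT (⊑-⇒ {U₁} {U₂} t₁ t₂ _ _) = trans (dT-⇒ U₁ t₁) (sym (dT-⇒ U₂ t₂))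
⊑-dT (⊑-ex p)            = cong suc (⊑-dT p)

⊑-good : ∀ {U V} → U ⊑ V → GoodTy U ⇔ GoodTy V
⊑-good (⊑-refl _ p)      = ≈-good p
⊑-good (⊑-trans p q)     = ⇔-trans (⊑-good p) (⊑-good q)
⊑-good (⊑-elim _ _ g₂ e) = mk⇔ (λ { (gt-⊓ g₁ _ _) → g₁ }) (λ g₁ → gt-⊓ g₁ g₂ e)
⊑-good (⊑-⊓ p q) = mk⇔
  (λ { (gt-⊓ a b e) → gt-⊓ (to (⊑-good p) a) (to (⊑-good q) b) (trans (sym (⊑-dT p)) (trans e (⊑-dT q))) })
  (λ { (gt-⊓ a b e) → gt-⊓ (from (⊑-good p) a) (from (⊑-good q) b) (trans (⊑-dT p) (trans e (sym (⊑-dT q)))) })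
⊑-good (⊑-⇒ t₁ t₂ p q) = mk⇔
  (λ { (gt-⇒ a b _) → gt-⇒ (from (⊑-good p) a) (to (⊑-good q) b) (subst (_≤ _) (sym (IsT-dT t₂)) z≤n) })
  (λ { (gt-⇒ a b _) → gt-⇒ (to (⊑-good p) a) (from (⊑-good q) b) (subst (_≤ _) (sym (IsT-dT t₁)) z≤n) })
⊑-good (⊑-ex p) = mk⇔ (λ { (gt-ex a) → gt-ex (to (⊑-good p) a) }) (λ { (gt-ex a) → gt-ex (from (⊑-good p) a) })

⊑-sem : ∀ {U V} → U ⊑ V → ∀ 𝓘 M → ⟦ U ⟧ 𝓘 M → ⟦ V ⟧ 𝓘 M
⊑-sem (⊑-refl _ p)     𝓘 M             = to (≈-sem p 𝓘 M)
⊑-sem (⊑-trans p q)    𝓘 M h           = ⊑-sem q 𝓘 M (⊑-sem p 𝓘 M h)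
⊑-sem (⊑-elim _ _ _ _) 𝓘 M             = proj₁
⊑-sem (⊑-⊓ p q)        𝓘 M (a , b)     = ⊑-sem p 𝓘 M a , ⊑-sem q 𝓘 M b
⊑-sem (⊑-⇒ _ _ p q)    𝓘 M (iM , f)    = iM , λ N h M◇N → ⊑-sem q 𝓘 _ (f N (⊑-sem p 𝓘 N h) M◇N)
⊑-sem (⊑-ex p)         𝓘 M (P , h , e) = P , ⊑-sem p 𝓘 P h , e

-- A fresh name of 𝒱₁ for a given term: twice a bound on its free names.
maxName : Tm → ℕ
maxName (fv x n)  = x
maxName (bv i n)  = 0
maxName (app M N) = maxName M ⊔ maxName N
maxName (lam n B) = maxName B

FV-maxName : ∀ {x k M} → FV x k M → x ≤ maxName M
FV-maxName fv-var = ≤-refl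
FV-maxName {M = app M N} (fv-appˡ p) = ≤-trans (FV-maxName p) (m≤m⊔n (maxName M) (maxName N))
FV-maxName {M = app M N} (fv-appʳ p) = ≤-trans (FV-maxName p) (m≤n⊔m (maxName M) (maxName N))
FV-maxName (fv-lam p) = FV-maxName p

fresh : Tm → ℕ
fresh M = 2 * suc (maxName M)

fresh-V₁ : ∀ M → V₁ (fresh M)
fresh-V₁ M = suc (maxName M) , refl

fresh-∉ : ∀ M k → ¬ FV (fresh M) k M
fresh-∉ M k p = <⇒≱ (m≤m+n (suc (maxName M)) (suc (maxName M) + 0)) (FV-maxName p)

Spine-deg : ∀ {z d M} → Spine z d M → Good M → deg M ≡ d
Spine-deg sp-var       _                = refl
Spine-deg (sp-app s) (g-app a _ _ le) = trans (m≤n⇒m⊓n≡m le) (Spine-deg s a)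

Spine-minus : ∀ {z d M} → Spine z (suc d) M → Spine z d (minus M)
Spine-minus sp-var     = sp-var
Spine-minus (sp-app s) = sp-app (Spine-minus s)

respine : ∀ {z d d' M} → d ≡ d' → Spine z d M → Spine z d' M
respine {z} {M = M} = subst (λ k → Spine z k M)

Good-app⁻ : ∀ {M N} → Good (app M N) → Good M × deg M ≤ deg N
Good-app⁻ (g-app gM _ _ dM≤dN) = gM , dM≤dN

-- The two facts are proved by simultaneous
-- induction because of the contravariance of the arrow.
mutual
  neutral-inhabits : ∀ U 𝓘 {z M} → GoodTy U → V₁ z → Spine z (dT U) M → Good M → ⟦ U ⟧ 𝓘 M
  neutral-inhabits (atom a) 𝓘 {z} {M} _ z∈V₁ sp g = neutral 𝓘 a z z∈V₁ M (sp , g)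
  neutral-inhabits (ex e U) 𝓘 {z} {M} (gt-ex gU) z∈V₁ sp g =
    minus M , neutral-inhabits U 𝓘 gU z∈V₁ (Spine-minus sp) (Good-minus g M⁺) , sym (plus-minus M M⁺)
    where M⁺ = deg→Positive (Good→IsTerm g) (subst (1 ≤_) (sym (Spine-deg sp g)) (s≤s z≤n))
  neutral-inhabits (U ⊓ᵗ V) 𝓘 (gt-⊓ gU gV e) z∈V₁ sp g =
    neutral-inhabits U 𝓘 gU z∈V₁ (respine (⊓-≡ˡ e) sp) g ,
    neutral-inhabits V 𝓘 gV z∈V₁ (respine (⊓-≡ʳ e) sp) g
  neutral-inhabits (U ⇒ T) 𝓘 {M = M} (gt-⇒ gU gT dT≤dU) z∈V₁ sp g = Good→IsTerm g , λ N hN M◇N →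
    let (gN , dN≡dU) = inhabitant-good U 𝓘 gU hN
        sp' = respine (m≥n⇒m⊓n≡n dT≤dU) sp
        dM≤dN = subst₂ _≤_ (sym (Spine-deg sp' g)) (sym dN≡dU) dT≤dU in
    neutral-inhabits T 𝓘 gT z∈V₁ (sp-app sp') (g-app g gN M◇N dM≤dN)

  inhabitant-good : ∀ U 𝓘 {M} → GoodTy U → ⟦ U ⟧ 𝓘 M → Good M × deg M ≡ dT U
  inhabitant-good (atom a) 𝓘 {M} _ h = good 𝓘 a M h
  inhabitant-good (ex e U) 𝓘 (gt-ex gU) (P , h , refl) =
    let (gP , dP) = inhabitant-good U 𝓘 gU h in Good-plus gP , trans (deg-plus P) (cong suc dP)
  inhabitant-good (U ⊓ᵗ V) 𝓘 (gt-⊓ gU gV e) (h , _) =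
    let (g , d) = inhabitant-good U 𝓘 gU h in g , trans d (sym (⊓-≡ˡ e))
  inhabitant-good (U ⇒ T) 𝓘 {M} (gt-⇒ gU gT dT≤dU) (_ , f) =
    let (gMz , dMz) = inhabitant-good T 𝓘 gT (f (fv z (dT U)) z∈U M◇z)
        (gM , dM≤dz) = Good-app⁻ gMz in
    gM , trans (trans (sym (m≤n⇒m⊓n≡m dM≤dz)) dMz) (sym (m≥n⇒m⊓n≡n dT≤dU))
    where
      -- M applied to a fresh variable z^{d(U)}, which inhabits ⟦ U ⟧ 𝓘
      z = fresh M
      z∈U = neutral-inhabits U 𝓘 gU (fresh-V₁ M) sp-var (g-var z (dT U))
      M◇z : Joinable M (fv z (dT U))
      M◇z x m n p fv-var = ⊥-elim (fresh-∉ M m p)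

extend-here : ∀ Γ x n U → extend Γ x n U x n ≡ just U
extend-here Γ x n U = if-same x n (just U) (Γ x n)

extend-there : ∀ Γ x n U y m → ¬ (y ≡ x × m ≡ n) → extend Γ x n U y m ≡ Γ y m
extend-there Γ x n U y m = if-other y m x n (just U) (Γ y m)

single-declared : ∀ x n T y m V → single x n T y m ≡ just V → y ≡ x × m ≡ n × V ≡ T
single-declared x n T y m V e with (y ≡ᵇ x) ∧ (m ≡ᵇ n) | match y m x n
single-declared x n T y m V refl | true  | same y≡x m≡n = y≡x , m≡n , refl
single-declared x n T y m V ()   | false | _

WellIndexed : Env → Set
WellIndexed Γ = ∀ x n V → Γ x n ≡ just V → GoodTy V × dT V ≡ n

record Coherent (Γ : Env) (M : Tm) (U : Ty) : Set where
  field
    domain   : ∀ x n → FV x n M ⇔ InDom Γ x n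
    env-good : WellIndexed Γ
    ty-good  : GoodTy U
    ty-deg   : dT U ≡ deg M
    is-term  : IsTerm M
open Coherent

coherent-ax : ∀ {x n T} → GoodTy T → dT T ≡ n → Coherent (single x n T) (fv x n) T
coherent-ax {x} {n} {T} gT dT≡n = record
  { domain   = λ y m → mk⇔ (λ { fv-var → T , extend-here ∅ x n T })
                           (λ (V , e) → case-declared (single-declared x n T y m V e))
  ; env-good = λ y m V e → case-good (single-declared x n T y m V e)
  ; ty-good  = gT ; ty-deg = dT≡n ; is-term = t-var x n }
  where
    case-declared : ∀ {y m V} → y ≡ x × m ≡ n × V ≡ T → FV y m (fv x n)
    case-declared (refl , refl , _) = fv-var
    case-good : ∀ {y m V} → y ≡ x × m ≡ n × V ≡ T → GoodTy V × dT V ≡ m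
    case-good (refl , refl , refl) = gT , dT≡n

coherent-→I : ∀ {Γ x n U M T} → Γ x n ≡ nothing → Coherent (extend Γ x n U) M T →
              Coherent Γ (ƛ x n M) (U ⇒ T)
coherent-→I {Γ} {x} {n} {U} {M} {T} x∉Γ C = record
  { domain   = λ y m → mk⇔
      (λ p → let (q , ne) = FV-ƛ⁻ p ; (V , e) = to (domain C y m) q in
             V , trans (sym (extend-there Γ x n U y m ne)) e)
      (λ (V , e) → let ne = other-than-x y m (V , e) in
                   FV-ƛ⁺ (from (domain C y m) (V , trans (extend-there Γ x n U y m ne) e)) ne)
  ; env-good = λ y m V e → env-good C y m V (trans (extend-there Γ x n U y m (other-than-x y m (V , e))) e)
  ; ty-good  = gt-⇒ gU (ty-good C) dT≤dU
  ; ty-deg   = trans (m≥n⇒m⊓n≡n dT≤dU) (trans (ty-deg C) (sym (deg-closeAt 0 x n M)))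
  ; is-term  = t-lam (is-term C) x∈M }
  where
    other-than-x : ∀ y m → InDom Γ y m → ¬ (y ≡ x × m ≡ n)
    other-than-x y m (V , e) (refl , refl) with trans (sym x∉Γ) e
    ... | ()
    x∈M : FV x n M
    x∈M = from (domain C x n) (U , extend-here Γ x n U)
    gU = proj₁ (env-good C x n U (extend-here Γ x n U))
    dT≤dU : dT T ≤ dT U
    dT≤dU = subst₂ _≤_ (sym (ty-deg C)) (sym (proj₂ (env-good C x n U (extend-here Γ x n U)))) (FV→deg x∈M)

meet-refinesˡ : ∀ {a b : Maybe Ty} {V} → a ≡ just V →
                Σ Ty λ W → meetM a b ≡ just W × (∀ 𝓘 N → ⟦ W ⟧ 𝓘 N → ⟦ V ⟧ 𝓘 N)
meet-refinesˡ {b = just _}  refl = _ , refl , λ _ _ → proj₁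
meet-refinesˡ {b = nothing} refl = _ , refl , λ _ _ h → h

meet-refinesʳ : ∀ {a b : Maybe Ty} {V} → b ≡ just V →
                Σ Ty λ W → meetM a b ≡ just W × (∀ 𝓘 N → ⟦ W ⟧ 𝓘 N → ⟦ V ⟧ 𝓘 N)
meet-refinesʳ {a = just _}  refl = _ , refl , λ _ _ → proj₂
meet-refinesʳ {a = nothing} refl = _ , refl , λ _ _ h → h

InDom-⊓ₑ : ∀ Γ₁ Γ₂ x n → (InDom Γ₁ x n ⊎ InDom Γ₂ x n) ⇔ InDom (Γ₁ ⊓ₑ Γ₂) x n
InDom-⊓ₑ Γ₁ Γ₂ x n = mk⇔
  (λ { (inj₁ (_ , e)) → let (W , e' , _) = meet-refinesˡ {b = Γ₂ x n} e in W , e'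
     ; (inj₂ (_ , e)) → let (W , e' , _) = meet-refinesʳ {a = Γ₁ x n} e in W , e' })
  (λ (_ , e) → declared (Γ₁ x n) (Γ₂ x n) e)
  where
    declared : ∀ a b {W} → meetM a b ≡ just W → (Σ Ty λ V → a ≡ just V) ⊎ (Σ Ty λ V → b ≡ just V)
    declared (just V) _        _ = inj₁ (V , refl)
    declared nothing  (just V) _ = inj₂ (V , refl)

WellIndexed-⊓ₑ : ∀ {Γ₁ Γ₂} → WellIndexed Γ₁ → WellIndexed Γ₂ → WellIndexed (Γ₁ ⊓ₑ Γ₂)
WellIndexed-⊓ₑ {Γ₁} {Γ₂} wi₁ wi₂ x n = combine (Γ₁ x n) (Γ₂ x n) (wi₁ x n) (wi₂ x n)
  where
    combine : ∀ a b → (∀ V → a ≡ just V → GoodTy V × dT V ≡ n) →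
              (∀ V → b ≡ just V → GoodTy V × dT V ≡ n) →
              ∀ V → meetM a b ≡ just V → GoodTy V × dT V ≡ n
    combine (just V₁) (just V₂) h₁ h₂ _ refl =
      let (g₁ , d₁) = h₁ V₁ refl ; (g₂ , d₂) = h₂ V₂ refl ; d₁≡d₂ = trans d₁ (sym d₂) in
      gt-⊓ g₁ g₂ d₁≡d₂ , trans (⊓-≡ˡ d₁≡d₂) d₁
    combine (just _)  nothing   h₁ _  = h₁
    combine nothing   (just _)  _  h₂ = h₂

FV-app : ∀ {M N} x n → FV x n (app M N) ⇔ (FV x n M ⊎ FV x n N)
FV-app x n = mk⇔ (λ { (fv-appˡ p) → inj₁ p ; (fv-appʳ p) → inj₂ p })
                 (λ { (inj₁ p) → fv-appˡ p ; (inj₂ p) → fv-appʳ p })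

coherent-→E : ∀ {Γ₁ Γ₂ M₁ M₂ U T} → Coherent Γ₁ M₁ (U ⇒ T) → Coherent Γ₂ M₂ U →
              EnvJoin Γ₁ Γ₂ →
              Coherent (Γ₁ ⊓ₑ Γ₂) (app M₁ M₂) T
coherent-→E {Γ₁} {Γ₂} {M₁} {M₂} C₁ C₂ Γ₁◇Γ₂ with ty-good C₁
... | gt-⇒ _ gT dT≤dU = record
  { domain   = λ x n → ⇔-trans (FV-app x n)
                                (⇔-trans (domain C₁ x n ⊎-⇔ domain C₂ x n) (InDom-⊓ₑ Γ₁ Γ₂ x n))
  ; env-good = WellIndexed-⊓ₑ (env-good C₁) (env-good C₂)
  ; ty-good  = gT
  ; ty-deg   = sym (trans (cong₂ _⊓_ (trans (sym (ty-deg C₁)) (m≥n⇒m⊓n≡n dT≤dU)) (sym (ty-deg C₂)))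
                          (m≤n⇒m⊓n≡m dT≤dU))
  ; is-term  = t-app (is-term C₁) (is-term C₂)
                     (λ x m n p q → Γ₁◇Γ₂ x m n (to (domain C₁ x m) p) (to (domain C₂ x n) q)) }

coherent-⊓I : ∀ {Γ₁ Γ₂ M U₁ U₂} → Coherent Γ₁ M U₁ → Coherent Γ₂ M U₂ →
              Coherent (Γ₁ ⊓ₑ Γ₂) M (U₁ ⊓ᵗ U₂)
coherent-⊓I {Γ₁} {Γ₂} C₁ C₂ = record
  { domain   = λ x n → ⇔-trans (mk⇔ inj₁ (λ { (inj₁ p) → p ; (inj₂ p) → p }))
                                (⇔-trans (domain C₁ x n ⊎-⇔ domain C₂ x n) (InDom-⊓ₑ Γ₁ Γ₂ x n))
  ; env-good = WellIndexed-⊓ₑ (env-good C₁) (env-good C₂)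
  ; ty-good  = gt-⊓ (ty-good C₁) (ty-good C₂) dU₁≡dU₂
  ; ty-deg   = trans (⊓-≡ˡ dU₁≡dU₂) (ty-deg C₁)
  ; is-term  = is-term C₁ }
  where dU₁≡dU₂ = trans (ty-deg C₁) (sym (ty-deg C₂))

expM-just⁻ : ∀ e (a : Maybe Ty) {V} → expM e a ≡ just V → Σ Ty λ V' → a ≡ just V' × V ≡ ex e V'
expM-just⁻ e (just V') refl = V' , refl , refl

coherent-exp : ∀ {Γ M U} e → Coherent Γ M U → Coherent (eEnv e Γ) (plus M) (ex e U)
coherent-exp {Γ} {M} {U} e C = record
  { domain   = λ y k → mk⇔ (fv→dom y k) (dom→fv y k)
  ; env-good = good-decl
  ; ty-good  = gt-ex (ty-good C)
  ; ty-deg   = trans (cong suc (ty-deg C)) (sym (deg-plus M))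
  ; is-term  = IsTerm-plus (is-term C) }
  where
    fv→dom : ∀ y k → FV y k (plus M) → InDom (eEnv e Γ) y k
    fv→dom y k p with FV-plus⁻ M p
    ... | k' , refl , q = let (V , eq) = to (domain C y k') q in ex e V , cong (expM e) eq
    dom→fv : ∀ y k → InDom (eEnv e Γ) y k → FV y k (plus M)
    dom→fv y (suc k) (V , eq) = let (V' , eq' , _) = expM-just⁻ e (Γ y k) eq in
                                FV-plus⁺ (from (domain C y k) (V' , eq'))
    good-decl : WellIndexed (eEnv e Γ)
    good-decl y (suc k) V eq with expM-just⁻ e (Γ y k) eq
    ... | V' , eq' , refl = let (g , d) = env-good C y k V' eq' in gt-ex g , cong suc d

-- The rules 'sub' and 'conv' only ever replace the
-- environment of a judgement by a declaration-wise refining one.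
record _≼_ (V' V : Ty) : Set₁ where
  field
    sem-⊆         : ∀ 𝓘 N → ⟦ V' ⟧ 𝓘 N → ⟦ V ⟧ 𝓘 N
    good-reflected : GoodTy V → GoodTy V'
    same-deg      : dT V' ≡ dT V
open _≼_

_≼ₑ_ : Env → Env → Set₁
Γ' ≼ₑ Γ = ∀ x n → Pointwise.Pointwise _≼_ (Γ' x n) (Γ x n)

≼-refl : ∀ {V} → V ≼ V
≼-refl = record { sem-⊆ = λ _ _ h → h ; good-reflected = λ g → g ; same-deg = refl }

≼-trans : ∀ {U V W} → U ≼ V → V ≼ W → U ≼ W
≼-trans r s = record { sem-⊆ = λ 𝓘 N h → sem-⊆ s 𝓘 N (sem-⊆ r 𝓘 N h)
                     ; good-reflected = λ g → good-reflected r (good-reflected s g)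
                     ; same-deg = trans (same-deg r) (same-deg s) }

≈→≼ : ∀ {U V} → U ≈ V → U ≼ V
≈→≼ p = record { sem-⊆ = λ 𝓘 M → to (≈-sem p 𝓘 M) ; good-reflected = from (≈-good p) ; same-deg = ≈-dT p }

⊑→≼ : ∀ {U V} → U ⊑ V → U ≼ V
⊑→≼ p = record { sem-⊆ = ⊑-sem p ; good-reflected = from (⊑-good p) ; same-deg = ⊑-dT p }

≅→≼ₑ : ∀ {Γ Γ'} → Γ ≅ Γ' → Γ' ≼ₑ Γ
≅→≼ₑ Γ≅Γ' x n = Pointwise.sym (λ p → ≈→≼ (≈-sym p)) (Γ≅Γ' x n)

⊑ₑ→≼ₑ : ∀ {Γ Γ'} → Γ ⊑ₑ Γ' → Γ ≼ₑ Γ'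
⊑ₑ→≼ₑ (⊑ₑ-refl Γ≅Γ') = ≅→≼ₑ (λ x n → Pointwise.sym ≈-sym (Γ≅Γ' x n))
⊑ₑ→≼ₑ (⊑ₑ-trans p q) x n = Pointwise.trans ≼-trans (⊑ₑ→≼ₑ p x n) (⊑ₑ→≼ₑ q x n)
⊑ₑ→≼ₑ (⊑ₑ-decl {Γ} {y} {n} {U₁} {U₂} _ U₁⊑U₂) x m with (x ≡ᵇ y) ∧ (m ≡ᵇ n)
... | true  = Pointwise.just (⊑→≼ U₁⊑U₂)
... | false = Pointwise.refl ≼-refl

refined-decl : ∀ {a b V} → Pointwise.Pointwise _≼_ a b → b ≡ just V → Σ Ty λ V' → a ≡ just V' × V' ≼ V
refined-decl (Pointwise.just r) refl = _ , refl , r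

refining-decl : ∀ {a b V'} → Pointwise.Pointwise _≼_ a b → a ≡ just V' → Σ Ty λ V → b ≡ just V × V' ≼ V
refining-decl (Pointwise.just r) refl = _ , refl , r

coherent-refine : ∀ {Γ' Γ M U} → Γ' ≼ₑ Γ → Coherent Γ M U → Coherent Γ' M U
coherent-refine Γ'≼Γ C = record
  { domain   = λ x n → ⇔-trans (domain C x n) (mk⇔
      (λ (_ , e) → let (V' , e' , _) = refined-decl (Γ'≼Γ x n) e in V' , e')
      (λ (_ , e') → let (V , e , _) = refining-decl (Γ'≼Γ x n) e' in V , e))
  ; env-good = λ x n V' e' → let (V , e , r) = refining-decl (Γ'≼Γ x n) e' ; (g , d) = env-good C x n V e in
                             good-reflected r g , trans (same-deg r) d
  ; ty-good  = ty-good C ; ty-deg = ty-deg C ; is-term = is-term C }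

coherent-retype : ∀ {Γ M U V} → Coherent Γ M U → GoodTy V → dT V ≡ dT U → Coherent Γ M V
coherent-retype C gV dV≡dU = record
  { domain = domain C ; env-good = env-good C ; ty-good = gV ; ty-deg = trans dV≡dU (ty-deg C) ; is-term = is-term C }

coherent₁ : ∀ {Γ M U} → Γ ⊢₁ M ∶ U → Coherent Γ M U
coherent₁ (ax gT dT≡n)    = coherent-ax gT dT≡n
coherent₁ (→I x∉Γ d)      = coherent-→I x∉Γ (coherent₁ d)
coherent₁ (→E d₁ d₂ Γ₁◇Γ₂) = coherent-→E (coherent₁ d₁) (coherent₁ d₂) Γ₁◇Γ₂
coherent₁ (⊓I d₁ d₂)      = coherent-⊓I (coherent₁ d₁) (coherent₁ d₂)
coherent₁ (exp e d)       = coherent-exp e (coherent₁ d)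
coherent₁ (conv d Γ≅Γ' U≈U') =
  let C = coherent-refine (≅→≼ₑ Γ≅Γ') (coherent₁ d) in
  coherent-retype C (to (≈-good U≈U') (ty-good C)) (sym (≈-dT U≈U'))

coherent₂ : ∀ {Γ M U} → Γ ⊢₂ M ∶ U → Coherent Γ M U
coherent₂ (ax isT gT)          = coherent-ax gT (IsT-dT isT)
coherent₂ (→I _ _ x∉Γ d)       = coherent-→I x∉Γ (coherent₂ d)
coherent₂ (→E _ _ d₁ d₂ Γ₁◇Γ₂) = coherent-→E (coherent₂ d₁) (coherent₂ d₂) Γ₁◇Γ₂
coherent₂ (⊓I _ _ d₁ d₂)       = coherent-⊓I (coherent₂ d₁) (coherent₂ d₂)
coherent₂ (exp e _ d)          = coherent-exp e (coherent₂ d)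
coherent₂ (sub d U⊑U' Γ'⊑Γ) =
  let C = coherent-refine (⊑ₑ→≼ₑ Γ'⊑Γ) (coherent₂ d) in
  coherent-retype C (to (⊑-good U⊑U') (ty-good C)) (sym (⊑-dT U⊑U'))
coherent₂ (conv d Γ≅Γ' U≈U') =
  let C = coherent-refine (≅→≼ₑ Γ≅Γ') (coherent₂ d) in
  coherent-retype C (to (≈-good U≈U') (ty-good C)) (sym (≈-dT U≈U'))

instantiate : (ℕ → ℕ → Tm) → Tm → Tm
instantiate v (fv x n)  = v x n
instantiate v (bv i n)  = bv i n
instantiate v (app M N) = app (instantiate v M) (instantiate v N)
instantiate v (lam n B) = lam n (instantiate v B)

substs≡instantiate : ∀ Γ σ M → substs Γ σ M ≡ instantiate (lookupSubst Γ σ) M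
substs≡instantiate Γ σ (fv x n)  = refl
substs≡instantiate Γ σ (bv i n)  = refl
substs≡instantiate Γ σ (app M N) = cong₂ app (substs≡instantiate Γ σ M) (substs≡instantiate Γ σ N)
substs≡instantiate Γ σ (lam n B) = cong (lam n) (substs≡instantiate Γ σ B)

lookupSubst-declared : ∀ Γ σ x n {V} → Γ x n ≡ just V → lookupSubst Γ σ x n ≡ σ x n
lookupSubst-declared Γ σ x n e with Γ x n
lookupSubst-declared Γ σ x n refl | just _ = refl

instantiate-id : ∀ M → instantiate fv M ≡ M
instantiate-id (fv x n)  = refl
instantiate-id (bv i n)  = refl
instantiate-id (app M N) = cong₂ app (instantiate-id M) (instantiate-id N)
instantiate-id (lam n B) = cong (lam n) (instantiate-id B)

instantiate-cong : ∀ {v w} M → (∀ y m → FV y m M → v y m ≡ w y m) → instantiate v M ≡ instantiate w M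
instantiate-cong (fv x n)  v≗w = v≗w x n fv-var
instantiate-cong (bv i n)  v≗w = refl
instantiate-cong (app M N) v≗w = cong₂ app (instantiate-cong M (λ y m p → v≗w y m (fv-appˡ p)))
                                           (instantiate-cong N (λ y m p → v≗w y m (fv-appʳ p)))
instantiate-cong (lam n B) v≗w = cong (lam n) (instantiate-cong B (λ y m p → v≗w y m (fv-lam p)))

FV-instantiate⁻ : ∀ {v w k} M → FV w k (instantiate v M) → Σ ℕ λ y → Σ ℕ λ m → FV y m M × FV w k (v y m)
FV-instantiate⁻ (fv x n)  p           = x , n , fv-var , p
FV-instantiate⁻ (app M N) (fv-appˡ p) = let (y , m , a , b) = FV-instantiate⁻ M p in y , m , fv-appˡ a , b
FV-instantiate⁻ (app M N) (fv-appʳ p) = let (y , m , a , b) = FV-instantiate⁻ N p in y , m , fv-appʳ a , b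
FV-instantiate⁻ (lam n B) (fv-lam p)  = let (y , m , a , b) = FV-instantiate⁻ B p in y , m , fv-lam a , b

FV-instantiate⁺ : ∀ {v w k y m M} → FV y m M → FV w k (v y m) → FV w k (instantiate v M)
FV-instantiate⁺ fv-var      q = q
FV-instantiate⁺ (fv-appˡ p) q = fv-appˡ (FV-instantiate⁺ p q)
FV-instantiate⁺ (fv-appʳ p) q = fv-appʳ (FV-instantiate⁺ p q)
FV-instantiate⁺ (fv-lam p)  q = fv-lam (FV-instantiate⁺ p q)

Joinable-instantiate : ∀ {v M N} → (∀ x n y m → FV x n M → FV y m N → Joinable (v x n) (v y m)) →
                       Joinable (instantiate v M) (instantiate v N)
Joinable-instantiate {M = M} {N} vM◇vN w k k' p q =
  let (y , m , p₁ , p₂) = FV-instantiate⁻ M p ; (y' , m' , q₁ , q₂) = FV-instantiate⁻ N q in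
  vM◇vN y m y' m' p₁ q₁ w k k' p₂ q₂

update : (ℕ → ℕ → Tm) → ℕ → ℕ → Tm → ℕ → ℕ → Tm
update v x n t y m = if (y ≡ᵇ x) ∧ (m ≡ᵇ n) then t else v y m

closeAt-∉ : ∀ k x n M → ¬ FV x n M → closeAt k x n M ≡ M
closeAt-∉ k x n (fv y m) x∉M with (y ≡ᵇ x) ∧ (m ≡ᵇ n) | match y m x n
... | true  | same refl refl = ⊥-elim (x∉M fv-var)
... | false | _              = refl
closeAt-∉ k x n (bv i m)  x∉M = refl
closeAt-∉ k x n (app M N) x∉M = cong₂ app (closeAt-∉ k x n M (λ p → x∉M (fv-appˡ p)))
                                          (closeAt-∉ k x n N (λ p → x∉M (fv-appʳ p)))
closeAt-∉ k x n (lam m B) x∉M = cong (lam m) (closeAt-∉ (suc k) x n B (λ p → x∉M (fv-lam p)))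

subst1-∉ : ∀ x n N M → ¬ FV x n M → subst1 x n N M ≡ M
subst1-∉ x n N (fv y m) x∉M with (y ≡ᵇ x) ∧ (m ≡ᵇ n) | match y m x n
... | true  | same refl refl = ⊥-elim (x∉M fv-var)
... | false | _              = refl
subst1-∉ x n N (bv i m)  x∉M = refl
subst1-∉ x n N (app M P) x∉M = cong₂ app (subst1-∉ x n N M (λ p → x∉M (fv-appˡ p)))
                                         (subst1-∉ x n N P (λ p → x∉M (fv-appʳ p)))
subst1-∉ x n N (lam m B) x∉M = cong (lam m) (subst1-∉ x n N B (λ p → x∉M (fv-lam p)))

instantiate-closeAt : ∀ k x n z v M → (∀ y m → FV y m M → ¬ (y ≡ x × m ≡ n) → ¬ FV z n (v y m)) →
  instantiate v (closeAt k x n M) ≡ closeAt k z n (instantiate (update v x n (fv z n)) M)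
instantiate-closeAt k x n z v (fv y m) z∉v with (y ≡ᵇ x) ∧ (m ≡ᵇ n) | match y m x n
... | true  | same refl refl = sym (if-same z n (bv k n) (fv z n))
... | false | other ne       = sym (closeAt-∉ k z n (v y m) (z∉v y m fv-var ne))
instantiate-closeAt k x n z v (bv i m)  z∉v = refl
instantiate-closeAt k x n z v (app M N) z∉v =
  cong₂ app (instantiate-closeAt k x n z v M (λ y m p → z∉v y m (fv-appˡ p)))
            (instantiate-closeAt k x n z v N (λ y m p → z∉v y m (fv-appʳ p)))
instantiate-closeAt k x n z v (lam m B) z∉v =
  cong (lam m) (instantiate-closeAt (suc k) x n z v B (λ y m p → z∉v y m (fv-lam p)))

instantiate-ƛ : ∀ x n M v z → ¬ FV z n (instantiate v (ƛ x n M)) →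
                instantiate v (ƛ x n M) ≡ ƛ z n (instantiate (update v x n (fv z n)) M)
instantiate-ƛ x n M v z z∉ = cong (lam n) (instantiate-closeAt 0 x n z v M
  (λ y m p ne q → z∉ (FV-instantiate⁺ (FV-ƛ⁺ p ne) q)))

subst1-instantiate : ∀ z n N v M → subst1 z n N (instantiate v M) ≡ instantiate (λ y m → subst1 z n N (v y m)) M
subst1-instantiate z n N v (fv x m)  = refl
subst1-instantiate z n N v (bv i m)  = refl
subst1-instantiate z n N v (app M P) = cong₂ app (subst1-instantiate z n N v M) (subst1-instantiate z n N v P)
subst1-instantiate z n N v (lam m B) = cong (lam m) (subst1-instantiate z n N v B)

instantiate-plus : ∀ v w M → (∀ y m → FV y m M → v y (suc m) ≡ plus (w y m)) →
                   instantiate v (plus M) ≡ plus (instantiate w M)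
instantiate-plus v w (fv x n)  v≗w⁺ = v≗w⁺ x n fv-var
instantiate-plus v w (bv i n)  v≗w⁺ = refl
instantiate-plus v w (app M N) v≗w⁺ = cong₂ app (instantiate-plus v w M (λ y m p → v≗w⁺ y m (fv-appˡ p)))
                                                (instantiate-plus v w N (λ y m p → v≗w⁺ y m (fv-appʳ p)))
instantiate-plus v w (lam n B) v≗w⁺ = cong (lam (suc n)) (instantiate-plus v w B (λ y m p → v≗w⁺ y m (fv-lam p)))

update-here : ∀ v x n t → update v x n t x n ≡ t
update-here v x n t = if-same x n t (v x n)

FV-update⁻ : ∀ {w k} v x n t y m → FV w k (update v x n t y m) →
             FV w k t ⊎ (¬ (y ≡ x × m ≡ n) × FV w k (v y m))
FV-update⁻ v x n t y m p with (y ≡ᵇ x) ∧ (m ≡ᵇ n) | match y m x n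
... | true  | _        = inj₁ p
... | false | other ne = inj₂ (ne , p)

TermsOn : Tm → (ℕ → ℕ → Tm) → Set
TermsOn M v = ∀ y m → FV y m M → IsTerm (v y m)

JoinableOn : Tm → (ℕ → ℕ → Tm) → Set
JoinableOn M v = ∀ x n y m → FV x n M → FV y m M → Joinable (v x n) (v y m)

TermsOn-update : ∀ {x n M v t} → TermsOn (ƛ x n M) v → IsTerm t → TermsOn M (update v x n t)
TermsOn-update {x} {n} vT it y m p with (y ≡ᵇ x) ∧ (m ≡ᵇ n) | match y m x n
... | true  | _        = it
... | false | other ne = vT y m (FV-ƛ⁺ p ne)

JoinableOn-update : ∀ {x n M v t} → JoinableOn (ƛ x n M) v → IsTerm t →
  (∀ y m → FV y m M → ¬ (y ≡ x × m ≡ n) → Joinable t (v y m)) → JoinableOn M (update v x n t)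
JoinableOn-update {x} {n} vJ it t◇v y m y' m' p p'
  with (y ≡ᵇ x) ∧ (m ≡ᵇ n) | match y m x n | (y' ≡ᵇ x) ∧ (m' ≡ᵇ n) | match y' m' x n
... | true  | _        | true  | _         = Joinable-self it
... | true  | _        | false | other ne' = t◇v y' m' p' ne'
... | false | other ne | true  | _         = Joinable-sym (t◇v y m p ne)
... | false | other ne | false | other ne' = vJ y m y' m' (FV-ƛ⁺ p ne) (FV-ƛ⁺ p' ne')

FreshFor : ℕ → Tm → Set
FreshFor z S = ∀ k → ¬ FV z k S

renaming-valid : ∀ {x n M v z} → TermsOn (ƛ x n M) v → JoinableOn (ƛ x n M) v →
  FreshFor z (instantiate v (ƛ x n M)) →
  TermsOn M (update v x n (fv z n)) × JoinableOn M (update v x n (fv z n))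
renaming-valid {x} {n} {M} {v} {z} vT vJ z∉ =
  TermsOn-update vT (t-var z n) , JoinableOn-update vJ (t-var z n) z◇v
  where
    z◇v : ∀ y m → FV y m M → ¬ (y ≡ x × m ≡ n) → Joinable (fv z n) (v y m)
    z◇v y m p ne _ _ k fv-var q = ⊥-elim (z∉ k (FV-instantiate⁺ (FV-ƛ⁺ p ne) q))

IsTerm-instantiate : ∀ {M} → IsTerm M → ∀ v → TermsOn M v → JoinableOn M v → IsTerm (instantiate v M)
IsTerm-instantiate (t-var x n) v vT vJ = vT x n fv-var
IsTerm-instantiate (t-app iM iN _) v vT vJ =
  t-app (IsTerm-instantiate iM v (λ y m p → vT y m (fv-appˡ p)) (λ y m y' m' p q → vJ y m y' m' (fv-appˡ p) (fv-appˡ q)))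
        (IsTerm-instantiate iN v (λ y m p → vT y m (fv-appʳ p)) (λ y m y' m' p q → vJ y m y' m' (fv-appʳ p) (fv-appʳ q)))
        (Joinable-instantiate (λ y m y' m' p q → vJ y m y' m' (fv-appˡ p) (fv-appʳ q)))
IsTerm-instantiate (t-lam {x} {n} {M} iM x∈M) v vT vJ =
  subst IsTerm (sym (instantiate-ƛ x n M v z (z∉ n)))
        (t-lam (IsTerm-instantiate iM _ v'T v'J) (FV-instantiate⁺ x∈M z∈v'x))
  where
    z  = fresh (instantiate v (ƛ x n M))
    z∉ = fresh-∉ (instantiate v (ƛ x n M))
    v'T = proj₁ (renaming-valid vT vJ z∉)
    v'J = proj₂ (renaming-valid vT vJ z∉)
    z∈v'x = subst (FV z n) (sym (update-here v x n (fv z n))) fv-var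

-- The β-step behind the abstraction case of soundness: an instance of
-- λx^n.M applied to a term N of degree n reduces to the instance of M at
-- the valuation updated with N at x^n.
β-instantiate : ∀ {x n M v N} → IsTerm M → FV x n M → TermsOn (ƛ x n M) v → JoinableOn (ƛ x n M) v →
  IsTerm N → deg N ≡ n → Joinable (instantiate v (ƛ x n M)) N →
  app (instantiate v (ƛ x n M)) N ▷β instantiate (update v x n N) M
β-instantiate {x} {n} {M} {v} {N} iM x∈M vT vJ iN dN≡n S◇N =
  subst₂ _▷β_ (cong (λ S → app S N) (sym S≡ƛzM')) contractum
        (β-redex (IsTerm-instantiate iM v' v'T v'J) iN z∈M' M'◇N dN≡n)
  where
    S = instantiate v (ƛ x n M)
    z = fresh (app S N)
    z∉S : FreshFor z S
    z∉S k p = fresh-∉ (app S N) k (fv-appˡ p)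
    z∉N : FreshFor z N
    z∉N k p = fresh-∉ (app S N) k (fv-appʳ p)
    v'  = update v x n (fv z n)
    M'  = instantiate v' M
    v'T = proj₁ (renaming-valid vT vJ z∉S)
    v'J = proj₂ (renaming-valid vT vJ z∉S)
    S≡ƛzM' : S ≡ ƛ z n M'
    S≡ƛzM' = instantiate-ƛ x n M v z (z∉S n)
    z∈M' : FV z n M'
    z∈M' = FV-instantiate⁺ x∈M (subst (FV z n) (sym (update-here v x n (fv z n))) fv-var)
    M'◇N : Joinable M' N
    M'◇N w k k' p q with FV-instantiate⁻ M p
    ... | y , m , p₁ , p₂ with FV-update⁻ v x n (fv z n) y m p₂
    ...   | inj₁ fv-var     = ⊥-elim (z∉N k' q)
    ...   | inj₂ (ne , p₂') = S◇N w k k' (FV-instantiate⁺ (FV-ƛ⁺ p₁ ne) p₂') q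
    contractum : subst1 z n N M' ≡ instantiate (update v x n N) M
    contractum = trans (subst1-instantiate z n N v' M) (instantiate-cong M agree)
      where
        agree : ∀ y m → FV y m M → subst1 z n N (v' y m) ≡ update v x n N y m
        agree y m p with (y ≡ᵇ x) ∧ (m ≡ᵇ n) | match y m x n
        ... | true  | _        = if-same z n N (fv z n)
        ... | false | other ne = subst1-∉ z n N (v y m) (λ q → z∉S n (FV-instantiate⁺ (FV-ƛ⁺ p ne) q))

Realizes : Interpretation → Env → (ℕ → ℕ → Tm) → Set
Realizes 𝓘 Γ v = ∀ x n V → Γ x n ≡ just V → ⟦ V ⟧ 𝓘 (v x n)

Valid : Interpretation → Env → Tm → Ty → Set
Valid 𝓘 Γ M U = ∀ v → Realizes 𝓘 Γ v → JoinableOn M v → ⟦ U ⟧ 𝓘 (instantiate v M)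

realizes-refine : ∀ {𝓘 Γ' Γ v} → Γ' ≼ₑ Γ → Realizes 𝓘 Γ' v → Realizes 𝓘 Γ v
realizes-refine {𝓘} {v = v} Γ'≼Γ vΓ' x n V e =
  let (V' , e' , r) = refined-decl (Γ'≼Γ x n) e in sem-⊆ r 𝓘 (v x n) (vΓ' x n V' e')

realizes-⊓ₑˡ : ∀ {𝓘 Γ₁ Γ₂ v} → Realizes 𝓘 (Γ₁ ⊓ₑ Γ₂) v → Realizes 𝓘 Γ₁ v
realizes-⊓ₑˡ {𝓘} {Γ₂ = Γ₂} vΓ x n V e =
  let (W , e' , W⊆V) = meet-refinesˡ {b = Γ₂ x n} e in W⊆V 𝓘 _ (vΓ x n W e')

realizes-⊓ₑʳ : ∀ {𝓘 Γ₁ Γ₂ v} → Realizes 𝓘 (Γ₁ ⊓ₑ Γ₂) v → Realizes 𝓘 Γ₂ v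
realizes-⊓ₑʳ {𝓘} {Γ₁} vΓ x n V e =
  let (W , e' , W⊆V) = meet-refinesʳ {a = Γ₁ x n} e in W⊆V 𝓘 _ (vΓ x n W e')

realizes-update : ∀ {𝓘 Γ x n U v N} → Realizes 𝓘 Γ v → ⟦ U ⟧ 𝓘 N →
                  Realizes 𝓘 (extend Γ x n U) (update v x n N)
realizes-update {𝓘} {x = x} {n} {N = N} vΓ N∈U y m V e with (y ≡ᵇ x) ∧ (m ≡ᵇ n) | match y m x n
... | true  | _ = subst (λ W → ⟦ W ⟧ 𝓘 N) (just-injective e) N∈U
... | false | _ = vΓ y m V e

realizes→TermsOn : ∀ {𝓘 Γ M U v} → Coherent Γ M U → Realizes 𝓘 Γ v → TermsOn M v
realizes→TermsOn {𝓘} {v = v} C vΓ y m p = let (V , e) = to (domain C y m) p in ⟦⟧-IsTerm V 𝓘 (v y m) (vΓ y m V e)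

-- Abstraction: by saturation, it suffices that the contractum of
-- β-instantiate is in ⟦ T ⟧ 𝓘, which is the induction hypothesis.
valid-→I : ∀ {Γ x n U M T} 𝓘 → Γ x n ≡ nothing → Coherent (extend Γ x n U) M T →
           Valid 𝓘 (extend Γ x n U) M T → Valid 𝓘 Γ (ƛ x n M) (U ⇒ T)
valid-→I {Γ} {x} {n} {U} {M} {T} 𝓘 x∉Γ C valid v vΓ vJ = IsTerm-instantiate (is-term Cƛ) v vT vJ , apply
  where
    Cƛ = coherent-→I x∉Γ C
    vT = realizes→TermsOn Cƛ vΓ
    x∈M = from (domain C x n) (U , extend-here Γ x n U)
    U-good = env-good C x n U (extend-here Γ x n U)
    apply : ∀ N → ⟦ U ⟧ 𝓘 N → Joinable (instantiate v (ƛ x n M)) N →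
            ⟦ T ⟧ 𝓘 (app (instantiate v (ƛ x n M)) N)
    apply N N∈U S◇N =
      ⟦⟧-saturated T 𝓘 _ _ (β-instantiate (is-term C) x∈M vT vJ iN dN≡n S◇N ◅ ε)
                   (valid (update v x n N) (realizes-update vΓ N∈U) (JoinableOn-update vJ iN N◇v))
      where
        iN = ⟦⟧-IsTerm U 𝓘 N N∈U
        dN≡n = trans (proj₂ (inhabitant-good U 𝓘 (proj₁ U-good) N∈U)) (proj₂ U-good)
        N◇v : ∀ y m → FV y m M → ¬ (y ≡ x × m ≡ n) → Joinable N (v y m)
        N◇v y m p ne w k k' q r = sym (S◇N w k' k (FV-instantiate⁺ (FV-ƛ⁺ p ne) r) q)

valid-→E : ∀ {Γ₁ Γ₂ M₁ M₂ U T} 𝓘 → Valid 𝓘 Γ₁ M₁ (U ⇒ T) → Valid 𝓘 Γ₂ M₂ U →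
           Valid 𝓘 (Γ₁ ⊓ₑ Γ₂) (app M₁ M₂) T
valid-→E {Γ₁} {Γ₂} {M₁} {M₂} 𝓘 valid₁ valid₂ v vΓ vJ =
  proj₂ (valid₁ v (realizes-⊓ₑˡ {Γ₁ = Γ₁} vΓ) (λ x n y m p q → vJ x n y m (fv-appˡ p) (fv-appˡ q)))
        (instantiate v M₂)
        (valid₂ v (realizes-⊓ₑʳ {Γ₁ = Γ₁} vΓ) (λ x n y m p q → vJ x n y m (fv-appʳ p) (fv-appʳ q)))
        (Joinable-instantiate (λ x n y m p q → vJ x n y m (fv-appˡ p) (fv-appʳ q)))

-- Expansion: the values realizing e Γ are lifts, and lowering them gives a
-- valuation realizing Γ.
valid-exp : ∀ {Γ M U} e 𝓘 → Coherent Γ M U → Valid 𝓘 Γ M U → Valid 𝓘 (eEnv e Γ) (plus M) (ex e U)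
valid-exp {Γ} {M} {U} e 𝓘 C valid v vΓ vJ =
  instantiate v⁻ M , valid v⁻ v⁻Γ v⁻J , instantiate-plus v v⁻ M v≡v⁻⁺
  where
    v⁻ : ℕ → ℕ → Tm
    v⁻ y m = minus (v y (suc m))
    lowered : ∀ y m V → Γ y m ≡ just V → ⟦ V ⟧ 𝓘 (v⁻ y m) × v y (suc m) ≡ plus (v⁻ y m)
    lowered y m V Γym≡V with vΓ y (suc m) (ex e V) (cong (expM e) Γym≡V)
    ... | P , P∈V , v≡P⁺ rewrite v≡P⁺ | minus-plus P = P∈V , refl
    v⁻Γ : Realizes 𝓘 Γ v⁻
    v⁻Γ y m V Γym≡V = proj₁ (lowered y m V Γym≡V)
    v≡v⁻⁺ : ∀ y m → FV y m M → v y (suc m) ≡ plus (v⁻ y m)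
    v≡v⁻⁺ y m p = let (V , Γym≡V) = to (domain C y m) p in proj₂ (lowered y m V Γym≡V)
    v⁻J : JoinableOn M v⁻
    v⁻J y m y' m' p q = Joinable-plus⁻ (subst₂ Joinable (v≡v⁻⁺ y m p) (v≡v⁻⁺ y' m' q)
                                                 (vJ y (suc m) y' (suc m') (FV-plus⁺ p) (FV-plus⁺ q)))

sound₁ : ∀ {Γ M U} → Γ ⊢₁ M ∶ U → ∀ 𝓘 → Valid 𝓘 Γ M U
sound₁ (ax {x} {n} {T} _ _) 𝓘 v vΓ _ = vΓ x n T (extend-here ∅ x n T)
sound₁ (→I x∉Γ d)     𝓘 = valid-→I 𝓘 x∉Γ (coherent₁ d) (sound₁ d 𝓘)
sound₁ (→E {U = U} {T} d₁ d₂ _) 𝓘 = valid-→E {U = U} {T} 𝓘 (sound₁ d₁ 𝓘) (sound₁ d₂ 𝓘)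
sound₁ (⊓I {Γ₁} d₁ d₂) 𝓘 v vΓ vJ =
  sound₁ d₁ 𝓘 v (realizes-⊓ₑˡ {Γ₁ = Γ₁} vΓ) vJ ,
  sound₁ d₂ 𝓘 v (realizes-⊓ₑʳ {Γ₁ = Γ₁} vΓ) vJ
sound₁ (exp e d)      𝓘 = valid-exp e 𝓘 (coherent₁ d) (sound₁ d 𝓘)
sound₁ (conv d Γ≅Γ' U≈U') 𝓘 v vΓ vJ =
  to (≈-sem U≈U' 𝓘 _) (sound₁ d 𝓘 v (realizes-refine (≅→≼ₑ Γ≅Γ') vΓ) vJ)

sound₂ : ∀ {Γ M U} → Γ ⊢₂ M ∶ U → ∀ 𝓘 → Valid 𝓘 Γ M U
sound₂ (ax {x} {T} _ _) 𝓘 v vΓ _ = vΓ x 0 T (extend-here ∅ x 0 T)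
sound₂ (→I _ _ x∉Γ d)   𝓘 = valid-→I 𝓘 x∉Γ (coherent₂ d) (sound₂ d 𝓘)
sound₂ (→E {U = U} {T} _ _ d₁ d₂ _) 𝓘 = valid-→E {U = U} {T} 𝓘 (sound₂ d₁ 𝓘) (sound₂ d₂ 𝓘)
sound₂ (⊓I {Γ₁} _ _ d₁ d₂) 𝓘 v vΓ vJ =
  sound₂ d₁ 𝓘 v (realizes-⊓ₑˡ {Γ₁ = Γ₁} vΓ) vJ ,
  sound₂ d₂ 𝓘 v (realizes-⊓ₑʳ {Γ₁ = Γ₁} vΓ) vJ
sound₂ (exp e _ d)      𝓘 = valid-exp e 𝓘 (coherent₂ d) (sound₂ d 𝓘)
sound₂ (sub d U⊑U' Γ'⊑Γ) 𝓘 v vΓ vJ =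
  ⊑-sem U⊑U' 𝓘 _ (sound₂ d 𝓘 v (realizes-refine (⊑ₑ→≼ₑ Γ'⊑Γ) vΓ) vJ)
sound₂ (conv d Γ≅Γ' U≈U') 𝓘 v vΓ vJ =
  to (≈-sem U≈U' 𝓘 _) (sound₂ d 𝓘 v (realizes-refine (≅→≼ₑ Γ≅Γ') vΓ) vJ)

coherent : ∀ i {Γ M U} → Γ ⊢[ i ] M ∶ U → Coherent Γ M U
coherent one = coherent₁
coherent two = coherent₂

sound : ∀ i {Γ M U} → Γ ⊢[ i ] M ∶ U → ∀ 𝓘 → Valid 𝓘 Γ M U
sound one = sound₁
sound two = sound₂

soundness : (i : Sys) (𝓘 : Interpretation) (Γ : Env) (M : Tm) (U : Ty) →
            Γ ⊢[ i ] M ∶ U → (σ : ℕ → ℕ → Tm) →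
            (∀ x n V → Γ x n ≡ just V → ⟦ V ⟧ 𝓘 (σ x n)) →
            SubstDefined Γ σ M → ⟦ U ⟧ 𝓘 (substs Γ σ M)
soundness i 𝓘 Γ M U d σ σ∈Γ (_ , σ◇σ) =
  subst (⟦ U ⟧ 𝓘) (sym (substs≡instantiate Γ σ M)) (sound i d 𝓘 (lookupSubst Γ σ) realizes joinable)
  where
    C = coherent i d
    realizes : Realizes 𝓘 Γ (lookupSubst Γ σ)
    realizes x n V e = subst (⟦ V ⟧ 𝓘) (sym (lookupSubst-declared Γ σ x n e)) (σ∈Γ x n V e)
    joinable : JoinableOn M (lookupSubst Γ σ)
    joinable x n y m p q =
      let (V , e) = to (domain C x n) p ; (W , e') = to (domain C y m) q in
      subst₂ Joinable (sym (lookupSubst-declared Γ σ x n e)) (sym (lookupSubst-declared Γ σ y m e'))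
             (σ◇σ x n y m (V , e) (W , e'))

-- A term typable in the empty environment is a closed term in [U]:
-- instantiate by the identity valuation.
closed-soundness : (i : Sys) (M : Tm) (U : Ty) → ∅ ⊢[ i ] M ∶ U → Meaning U M
closed-soundness i M U d = is-term C , closed , λ 𝓘 →
  subst (⟦ U ⟧ 𝓘) (instantiate-id M) (sound i d 𝓘 fv (λ _ _ _ ()) (λ x n _ _ p → ⊥-elim (closed x n p)))
  where
    C = coherent i d
    closed : Closed M
    closed x n p with proj₂ (to (domain C x n) p)
    ... | ()

lemma2 : ((i : Sys) (𝓘 : Interpretation) (Γ : Env) (M : Tm) (U : Ty) →
             Γ ⊢[ i ] M ∶ U →
             (σ : ℕ → ℕ → Tm) →
             (∀ x n V → Γ x n ≡ just V → ⟦ V ⟧ 𝓘 (σ x n)) →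
             SubstDefined Γ σ M →
             ⟦ U ⟧ 𝓘 (substs Γ σ M))
           × ((i : Sys) (M : Tm) (U : Ty) → ∅ ⊢[ i ] M ∶ U → Meaning U M)
lemma2 = soundness , closed-soundness
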